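{- Let $G=(V,E)$ be a finite, connected, undirected graph (multiple edges allowed) with at least one edge, let $\mu^*$ be an optimal pmf for the Fairest Edge Usage problem on $G$ with edge usage probabilities $\eta^*$, let $J\subseteq E$ be a critical set, let $V_i$ be the vertex set of one of the connected components of $(V,E\setminus J)$, let $E_i$ be the set of edges of $G$ with both endpoints in $V_i$, $G_i=(V_i,E_i)$, and let $\mu_i$ be any pmf on the set $\Gamma_i$ of spanning trees of $G_i$, with edge usage probabilities $\eta_i$ (on $E_i$). Then there exists a pmf $\mu$ on $\Gamma$ whose edge usage probabilities $\eta$ satisfy $\eta(e)=\eta_i(e)$ for $e\in E_i$ and $\eta(e)=\eta^*(e)$ for $e\in E\setminus E_i$.
   Context: $\Gamma$ denotes the set of spanning trees of $G$, each viewed as a set of edges. For a probability mass function (pmf) $\mu$ on a family of spanning trees of a graph, its edge usage probabilities are $\eta(e)=\sum_{\gamma:\,e\in\gamma}\mu(\gamma)$. The Fairest Edge Usage problem on $G$ is to minimize $\sum_{e\in E}\eta(e)^2$ over all pmfs $\mu$ on $\Gamma$; a minimizer is an optimal pmf. For $J\subseteq E$, $\mathcal{M}(J)=\min_{\gamma\in\Gamma}|\gamma\cap J|$, and $\theta(J)=\mathcal{M}(J)/|J|$ if $J\neq\emptyset$, $\theta(\emptyset)=0$. $\theta(G)=\max_{J\subseteq E}\theta(J)$, and $J$ is critical if $\theta(J)=\theta(G)$.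
   Formalization: The pmfs $\mu^*$, $\mu_i$ and $\mu$ take rational values, and optimality of $\mu^*$ is taken among rational pmfs on $\Gamma$. -}

module Defs where

open import Data.Nat using (ℕ; zero; suc)
open import Data.Fin using (Fin)
open import Data.Fin.Subset using (Subset; _∈_; _∉_; _∩_; ∣_∣; inside; outside)
open import Data.Vec using (Vec; []; _∷_; lookup)
open import Data.List using (List; []; _∷_; map; _++_; foldr; allFin)
open import Data.Bool using (if_then_else_)
open import Data.Integer using (+_)
open import Data.Rational using (ℚ; 0ℚ; 1ℚ; _+_; _*_; _≤_; _/_)
open import Data.Product using (_×_; Σ; ∃)
open import Data.Unit using (⊤)
open import Relation.Binary.PropositionalEquality using (_≡_; _≢_)
open import Relation.Nullary using (¬_)

-- A finite undirected multigraph (no loops) with vertices Fin n and edges Fin m;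
-- edge e joins src e and tgt e (orientation irrelevant).
record Multigraph (n m : ℕ) : Set where
  field
    src tgt : Fin m → Fin n
    loopless : ∀ e → src e ≢ tgt e
open Multigraph public

module _ {n m : ℕ} (G : Multigraph n m) where

  data Reach (A : Fin m → Set) : Fin n → Fin n → Set where
    here : ∀ {u} → Reach A u u
    fwd  : ∀ {u} e → A e → Reach A u (src G e) → Reach A u (tgt G e)
    bwd  : ∀ {u} e → A e → Reach A u (tgt G e) → Reach A u (src G e)

  Connected : Set
  Connected = ∀ u w → Reach (λ _ → ⊤) u w

  Acyclic : Subset m → Set
  Acyclic T = ∀ e → e ∈ T → ¬ Reach (λ f → f ∈ T × f ≢ e) (src G e) (tgt G e)

  -- T is a spanning tree of the subgraph (P, {edges with both endpoints in P}).
  SpanningTreeOn : (Fin n → Set) → Subset m → Set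
  SpanningTreeOn P T =
    (∀ e → e ∈ T → P (src G e) × P (tgt G e)) ×
    (∀ u w → P u → P w → Reach (λ f → f ∈ T) u w) ×
    Acyclic T

  SpanningTree : Subset m → Set
  SpanningTree = SpanningTreeOn (λ _ → ⊤)

-- All subsets of Fin m (each exactly once)
allSubsets : (m : ℕ) → List (Subset m)
allSubsets zero = [] ∷ []
allSubsets (suc m) = map (inside ∷_) (allSubsets m) ++ map (outside ∷_) (allSubsets m)

sumℚ : List ℚ → ℚ
sumℚ = foldr _+_ 0ℚ

IsPMF : {m : ℕ} → (Subset m → Set) → (Subset m → ℚ) → Set
IsPMF {m} P μ =
  (∀ T → 0ℚ ≤ μ T) × (∀ T → μ T ≢ 0ℚ → P T) × (sumℚ (map μ (allSubsets m)) ≡ 1ℚ)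

usage : {m : ℕ} → (Subset m → ℚ) → Fin m → ℚ
usage {m} μ e = sumℚ (map (λ T → if lookup T e then μ T else 0ℚ) (allSubsets m))

cost : {m : ℕ} → (Subset m → ℚ) → ℚ
cost {m} μ = sumℚ (map (λ e → usage μ e * usage μ e) (allFin m))

module _ {n m : ℕ} (G : Multigraph n m) where

  OptimalPMF : (Subset m → ℚ) → Set
  OptimalPMF μ = IsPMF (SpanningTree G) μ ×
    (∀ ν → IsPMF (SpanningTree G) ν → cost μ ≤ cost ν)

  IsM : Subset m → ℕ → Set
  IsM J k = (Σ (Subset m) λ γ → SpanningTree G γ × ∣ γ ∩ J ∣ ≡ k) ×
            (∀ γ → SpanningTree G γ → k ≤ℕ ∣ γ ∩ J ∣)
    where open import Data.Nat renaming (_≤_ to _≤ℕ_)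

θval : ℕ → ℕ → ℚ
θval k zero = 0ℚ
θval k (suc d) = (+ k) / suc d

module _ {n m : ℕ} (G : Multigraph n m) where

  IsTheta : Subset m → ℚ → Set
  IsTheta J t = Σ ℕ λ k → IsM G J k × t ≡ θval k ∣ J ∣

  Critical : Subset m → Set
  Critical J = Σ ℚ λ t → IsTheta J t × (∀ J' t' → IsTheta J' t' → t' ≤ t)

-- Let η be the edge usage of the optimal μ*. Moving mass ε from a support tree γ to another
-- spanning tree γ′ changes the cost by 2ε (η(γ′) − η(γ)) + O(ε²), so every support tree is a
-- minimum η-weight spanning tree. Let K be the set of edges of maximum usage ηmax. By the cycle
-- property a minimum-weight tree meets K in as few edges as any spanning tree does, so all support
-- trees meet K in 𝓜(K) edges and η(K) = 𝓜(K), i.e. θ(K) = ηmax. For the critical J this gives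
-- E|γ ∩ J| = η(J) ≤ ηmax |J| ≤ θ(J) |J| = 𝓜(J), so every support tree meets J in exactly 𝓜(J) edges.
-- Such a tree, with J removed, spans each component of G ∖ J; hence it restricts to a spanning tree
-- of G_i, and replacing that restriction by any spanning tree of G_i again gives a spanning tree of G.
-- Drawing γ from μ* and S from μ_i independently and splicing S into γ yields a pmf that uses the
-- edges of E_i as μ_i does and all other edges as μ* does.

module Submission where

open import Defs
open import Data.Bool using (Bool; true; false; if_then_else_)
import Data.Bool as Bool
open import Data.Empty using (⊥-elim)
open import Data.Fin using (Fin; zero; suc)
open import Data.Fin.Properties using (_≟_; any?)
open import Data.Fin.Subset using (Subset; _∈_; _∉_; _∩_; _─_; ⁅_⁆; ∁; ∣_∣; inside; outside)
  renaming (_⊆_ to _⊆ₛ_)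
import Data.Fin.Subset as Subset
open import Data.Fin.Subset.Properties
  using (_∈?_; x∈p∪q⁻; x∈p∪q⁺; x∈p∩q⁻; x∈p∩q⁺; p─q⊆p; x∈⁅x⁆; x∈⁅y⁆⇒x≡y; x∈p∧x≢y⇒x∈p-y; x∈p⇒∣p-x∣<∣p∣;
         ∣p─q∣≤∣p∣; p⊆q⇒∣p∣≤∣q∣; ∣⁅x⁆∣≡1; ∣p∣≤∣x∷p∣; x∉p⇒x∈∁p; x∈p⇒x∉∁p)
open import Data.Integer as ℤ using ()
open import Data.Integer.Solver using () renaming (module +-*-Solver to ℤ-Solver)
open import Data.List using (List; []; _∷_; _++_; map; allFin)
open import Data.List.Membership.Propositional using () renaming (_∈_ to _∈ₗ_)
open import Data.List.Membership.Propositional.Properties using (∈-allFin; ∈-map⁺; ∈-++⁺ˡ; ∈-++⁺ʳ)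
open import Data.List.Properties using (map-∘; map-tabulate)
open import Data.List.Relation.Unary.Any using (here; there)
open import Data.Nat as ℕ using (ℕ; zero; suc; z≤n; s≤s)
open import Data.Nat.Induction using (<-wellFounded)
import Data.Nat.Properties as ℕₚ
open import Data.Product using (_×_; Σ; ∃; _,_; proj₁; proj₂)
open import Data.Rational
  using (ℚ; 0ℚ; 1ℚ; _+_; _*_; _-_; -_; _≤_; _<_; _/_; 1/_; toℚᵘ; Positive; NonZero; positive; nonNegative)
import Data.Rational.Properties as ℚ
open import Data.Rational.Solver using () renaming (module +-*-Solver to ℚ-Solver)
open import Data.Rational.Unnormalised as ℚᵘ using (mkℚᵘ; *≡*)
import Data.Rational.Unnormalised.Properties as ℚᵘ
open import Data.Sum using (_⊎_; inj₁; inj₂; [_,_]′)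
import Data.Sum as Sum
open import Data.Unit using (tt)
open import Data.Vec using (_∷_; []; here; there; lookup; tabulate)
open import Data.Vec.Properties using (lookup∘tabulate; []=⇒lookup; lookup⇒[]=; ≡-dec; lookup-zipWith)
open import Function using (_∘_; id; case_of_)
open import Induction.WellFounded using (Acc; acc)
open import Level using (0ℓ)
open import Relation.Binary.Definitions using (DecidableEquality; tri<; tri≈; tri>)
open import Relation.Binary.PropositionalEquality
  using (_≡_; _≢_; refl; sym; trans; cong; cong₂; subst; subst₂; module ≡-Reasoning)
open import Relation.Nullary using (¬_; Dec; yes; no; does)
open import Relation.Nullary.Decidable using (map′; _×-dec_; _⊎-dec_; ¬?; decidable-stable)
open import Relation.Unary using (Pred; Decidable; _⊆_; _∪_; ∅)
open import Relation.Unary.Properties using (_∪?_)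

-- Walks

EdgeSet : ℕ → Set₁
EdgeSet m = Pred (Fin m) 0ℓ

_∖｛_｝ : ∀ {m} → EdgeSet m → Fin m → EdgeSet m
(P ∖｛ h ｝) f = P f × f ≢ h

Via : ∀ {n m} → Multigraph n m → EdgeSet m → Fin m → Fin n → Fin n → Set
Via G P h u w = (Reach G P u (src G h) × Reach G P (tgt G h) w) ⊎
                (Reach G P u (tgt G h) × Reach G P (src G h) w)

module _ {n m : ℕ} {G : Multigraph n m} where

  open import Data.List.Membership.DecPropositional (_≟_ {m}) using () renaming (_∈?_ to _∈ₗ?_)

  Reach-mono : ∀ {P Q : EdgeSet m} → P ⊆ Q → ∀ {u w} → Reach G P u w → Reach G Q u w
  Reach-mono P⊆Q here        = here
  Reach-mono P⊆Q (fwd e p r) = fwd e (P⊆Q p) (Reach-mono P⊆Q r)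
  Reach-mono P⊆Q (bwd e p r) = bwd e (P⊆Q p) (Reach-mono P⊆Q r)

  Reach-trans : ∀ {P u x w} → Reach G P u x → Reach G P x w → Reach G P u w
  Reach-trans r here         = r
  Reach-trans r (fwd e p r′) = fwd e p (Reach-trans r r′)
  Reach-trans r (bwd e p r′) = bwd e p (Reach-trans r r′)

  Reach-sym : ∀ {P u w} → Reach G P u w → Reach G P w u
  Reach-sym here        = here
  Reach-sym (fwd e p r) = Reach-trans (bwd e p here) (Reach-sym r)
  Reach-sym (bwd e p r) = Reach-trans (fwd e p here) (Reach-sym r)

  Reach-bind : ∀ {P Q : EdgeSet m} → (∀ {e} → P e → Reach G Q (src G e) (tgt G e)) →
               ∀ {u w} → Reach G P u w → Reach G Q u w
  Reach-bind f here        = here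
  Reach-bind f (fwd e p r) = Reach-trans (Reach-bind f r) (f p)
  Reach-bind f (bwd e p r) = Reach-trans (Reach-bind f r) (Reach-sym (f p))

  Reach-∅ : ∀ {P : EdgeSet m} → (∀ e → ¬ P e) → ∀ {u w} → Reach G P u w → u ≡ w
  Reach-∅ ¬P here        = refl
  Reach-∅ ¬P (fwd e p _) = ⊥-elim (¬P e p)
  Reach-∅ ¬P (bwd e p _) = ⊥-elim (¬P e p)

  Via-mono : ∀ {P Q : EdgeSet m} → P ⊆ Q → ∀ {h u w} → Via G P h u w → Via G Q h u w
  Via-mono P⊆Q (inj₁ (a , b)) = inj₁ (Reach-mono P⊆Q a , Reach-mono P⊆Q b)
  Via-mono P⊆Q (inj₂ (a , b)) = inj₂ (Reach-mono P⊆Q a , Reach-mono P⊆Q b)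

  Via-cycle : ∀ {P h u w} → Via G P h u w → Reach G P u w → Reach G P (src G h) (tgt G h)
  Via-cycle (inj₁ (a , b)) r = Reach-trans (Reach-sym a) (Reach-trans r (Reach-sym b))
  Via-cycle (inj₂ (a , b)) r = Reach-trans b (Reach-trans (Reach-sym r) a)

  Via-join : ∀ {P h u w} → Reach G P (src G h) (tgt G h) → Via G P h u w → Reach G P u w
  Via-join r (inj₁ (a , b)) = Reach-trans a (Reach-trans r b)
  Via-join r (inj₂ (a , b)) = Reach-trans a (Reach-trans (Reach-sym r) b)

  private
    Split : EdgeSet m → Fin m → Fin n → Fin n → Set
    Split P h u w = Reach G (P ∖｛ h ｝) u w ⊎ Via G (P ∖｛ h ｝) h u w

    Split-extend : ∀ {P h u x w} → Split P h u x → Reach G (P ∖｛ h ｝) x w → Split P h u w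
    Split-extend (inj₁ a)              r = inj₁ (Reach-trans a r)
    Split-extend (inj₂ (inj₁ (a , b))) r = inj₂ (inj₁ (a , Reach-trans b r))
    Split-extend (inj₂ (inj₂ (a , b))) r = inj₂ (inj₂ (a , Reach-trans b r))

    Split-fwd : ∀ {P h u} → Split P h u (src G h) → Split P h u (tgt G h)
    Split-fwd (inj₁ a)              = inj₂ (inj₁ (a , here))
    Split-fwd (inj₂ (inj₁ (a , _))) = inj₂ (inj₁ (a , here))
    Split-fwd (inj₂ (inj₂ (a , _))) = inj₁ a

    Split-bwd : ∀ {P h u} → Split P h u (tgt G h) → Split P h u (src G h)
    Split-bwd (inj₁ a)              = inj₂ (inj₂ (a , here))
    Split-bwd (inj₂ (inj₁ (a , _))) = inj₁ a
    Split-bwd (inj₂ (inj₂ (a , _))) = inj₂ (inj₂ (a , here))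

  Reach-split : ∀ {P} h {u w} → Reach G (P ∪ (_≡ h)) u w → Reach G (P ∖｛ h ｝) u w ⊎ Via G (P ∖｛ h ｝) h u w
  Reach-split h here = inj₁ here
  Reach-split h (fwd e (inj₂ refl) r) = Split-fwd (Reach-split h r)
  Reach-split h (fwd e (inj₁ p) r) with e ≟ h
  ... | yes refl = Split-fwd (Reach-split h r)
  ... | no e≢h   = Split-extend (Reach-split h r) (fwd e (p , e≢h) here)
  Reach-split h (bwd e (inj₂ refl) r) = Split-bwd (Reach-split h r)
  Reach-split h (bwd e (inj₁ p) r) with e ≟ h
  ... | yes refl = Split-bwd (Reach-split h r)
  ... | no e≢h   = Split-extend (Reach-split h r) (bwd e (p , e≢h) here)

  private
    Within : EdgeSet m → List (Fin m) → EdgeSet m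
    Within P L f = P f × f ∈ₗ L

    Within-∷ : ∀ {P g L} → Within P (g ∷ L) ⊆ Within P L ∪ (_≡ g)
    Within-∷ (p , here refl) = inj₂ refl
    Within-∷ (p , there f∈L) = inj₁ (p , f∈L)

    Within-there : ∀ {P g L} → Within P L ⊆ Within P (g ∷ L)
    Within-there (p , f∈L) = p , there f∈L

    Within-drop : ∀ {P g L} → ¬ P g → Within P (g ∷ L) ⊆ Within P L
    Within-drop ¬pg (p , here refl) = ⊥-elim (¬pg p)
    Within-drop ¬pg (p , there f∈L) = p , f∈L

    Via? : ∀ {P} → (∀ u w → Dec (Reach G P u w)) → ∀ h u w → Dec (Via G P h u w)
    Via? R? h u w = (R? u (src G h) ×-dec R? (tgt G h) w) ⊎-dec (R? u (tgt G h) ×-dec R? (src G h) w)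

    Within? : ∀ {P} → Decidable P → ∀ L → Decidable (Within P L)
    Within? P? L f = P? f ×-dec (f ∈ₗ? L)

    Reach-within? : ∀ {P} → Decidable P → ∀ L u w → Dec (Reach G (Within P L) u w)
    Reach-within? P? [] u w =
      map′ (λ { refl → here }) (Reach-∅ (λ { _ (_ , ()) })) (u ≟ w)
    Reach-within? {P} P? (g ∷ L) u w with Reach-within? P? L u w | P? g
    ... | yes r | _      = yes (Reach-mono (Within-there {P}) r)
    ... | no ¬r | no ¬pg = no (¬r ∘ Reach-mono (Within-drop {P} ¬pg))
    ... | no ¬r | yes pg =
      map′ (Via-join (fwd g (pg , here refl) here) ∘ Via-mono (Within-there {P}))
           (λ r → [ ⊥-elim ∘ ¬r ∘ Reach-mono proj₁ , Via-mono proj₁ ]′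
                    (Reach-split g (Reach-mono (Within-∷ {P}) r)))
           (Via? (Reach-within? P? L) g u w)

  Reach? : ∀ {P} → Decidable P → ∀ u w → Dec (Reach G P u w)
  Reach? P? u w =
    map′ (Reach-mono proj₁) (Reach-mono (λ {f} p → p , ∈-allFin f)) (Reach-within? P? (allFin m) u w)

  bridge : ∀ {B Q : EdgeSet m} → Decidable B → Decidable Q → ∀ {u w} →
           Reach G (B ∪ Q) u w → ¬ Reach G B u w → ∃ λ g → Q g × Via G ((B ∪ Q) ∖｛ g ｝) g u w
  bridge {B} {Q} B? Q? r ¬r = go (allFin m) (Reach-mono (λ {f} → [ inj₁ , (λ q → inj₂ (q , ∈-allFin f)) ]′) r) ¬r
    where
    go : ∀ L {u w} → Reach G (B ∪ Within Q L) u w → ¬ Reach G B u w →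
         ∃ λ g → Q g × Via G ((B ∪ Q) ∖｛ g ｝) g u w
    go [] r ¬r = ⊥-elim (¬r (Reach-mono [ (λ b → b) , (λ { (_ , ()) }) ]′ r))
    go (g ∷ L) {u} {w} r ¬r with Reach? (B? ∪? Within? Q? L) u w | Q? g
    ... | yes r′ | _      = go L r′ ¬r
    ... | no ¬r′ | no ¬qg = ⊥-elim (¬r′ (Reach-mono (Sum.map₂ (Within-drop {Q} ¬qg)) r))
    ... | no ¬r′ | yes qg =
      g , qg , [ ⊥-elim ∘ ¬r′ ∘ Reach-mono proj₁ , Via-mono (λ (p , f≢g) → Sum.map₂ proj₁ p , f≢g) ]′
                 (Reach-split g (Reach-mono [ inj₁ ∘ inj₁ , Sum.map₁ inj₂ ∘ Within-∷ {Q} ]′ r))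

  tree-cut : ∀ {T : Subset m} {A : EdgeSet m} → Acyclic G T → Decidable A → A ⊆ (_∈ T) →
             ∀ {u w} → Reach G (_∈ T) u w → ¬ Reach G A u w →
             ∃ λ g → g ∈ T × ¬ A g × ¬ Reach G ((_∈ T) ∖｛ g ｝) u w
  tree-cut {T} {A} acyclic A? A⊆T {u} {w} r ¬r = cut (bridge A? Rest? (Reach-mono split r) ¬r)
    where
    Rest : EdgeSet m
    Rest f = f ∈ T × ¬ A f
    Rest? : Decidable Rest
    Rest? f = (f ∈? T) ×-dec ¬? (A? f)
    split : (_∈ T) ⊆ A ∪ Rest
    split {f} f∈T with A? f
    ... | yes a = inj₁ a
    ... | no ¬a = inj₂ (f∈T , ¬a)
    cut : (∃ λ g → Rest g × Via G ((A ∪ Rest) ∖｛ g ｝) g u w) →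
          ∃ λ g → g ∈ T × ¬ A g × ¬ Reach G ((_∈ T) ∖｛ g ｝) u w
    cut (g , (g∈T , ¬ag) , via) =
      g , g∈T , ¬ag , λ r′ → acyclic g g∈T (Via-cycle (Via-mono (λ (p , ne) → [ A⊆T , proj₁ ]′ p , ne) via) r′)

  crossing-edge : ∀ {P Q : EdgeSet m} → Decidable Q → ∀ {u w} → Reach G P u w → ¬ Reach G Q u w →
                  ∃ λ h → P h × ¬ Reach G Q (src G h) (tgt G h)
  crossing-edge Q? here ¬r = ⊥-elim (¬r here)
  crossing-edge Q? {u} (fwd e p r) ¬r with Reach? Q? u (src G e)
  ... | yes a = e , p , λ q → ¬r (Reach-trans a q)
  ... | no ¬a = crossing-edge Q? r ¬a
  crossing-edge Q? {u} (bwd e p r) ¬r with Reach? Q? u (tgt G e)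
  ... | yes a = e , p , λ q → ¬r (Reach-trans a (Reach-sym q))
  ... | no ¬a = crossing-edge Q? r ¬a

  acyclic-disjoint-walks : ∀ {T : Subset m} {A B : EdgeSet m} → Acyclic G T → A ⊆ (_∈ T) → B ⊆ (_∈ T) →
                           (∀ {f} → A f → ¬ B f) → ∀ {x y} → Reach G A x y → Reach G B x y → x ≡ y
  acyclic-disjoint-walks {T} acyclic A⊆T B⊆T disjoint {x} {y} ra rb with x ≟ y
  ... | yes x≡y = x≡y
  ... | no x≢y with tree-cut {A = ∅} acyclic (λ _ → no (λ ())) (λ ()) (Reach-mono A⊆T ra) (x≢y ∘ Reach-∅ (λ _ ()))
  ...   | g , g∈T , _ , ¬r = ⊥-elim (uses A⊆T ra λ a → uses B⊆T rb λ b → disjoint a b)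
    where
    uses : ∀ {C : EdgeSet m} → C ⊆ (_∈ T) → Reach G C x y → ¬ ¬ C g
    uses C⊆T rc ¬cg = ¬r (Reach-mono (λ c → C⊆T c , λ { refl → ¬cg c }) rc)

  tree-connects : ∀ {T} → SpanningTree G T → ∀ u w → Reach G (_∈ T) u w
  tree-connects (_ , connects , _) u w = connects u w tt tt

  tree-acyclic : ∀ {T} → SpanningTree G T → Acyclic G T
  tree-acyclic (_ , _ , acyclic) = acyclic

  spanningTree : ∀ {T} → (∀ u w → Reach G (_∈ T) u w) → Acyclic G T → SpanningTree G T
  spanningTree connects acyclic = (λ _ _ → tt , tt) , (λ u w _ _ → connects u w) , acyclic

-- Exchanging an edge of a spanning tree

∣p∪q∣≤∣p∣+∣q∣ : ∀ {m} (p q : Subset m) → ∣ p Subset.∪ q ∣ ℕ.≤ ∣ p ∣ ℕ.+ ∣ q ∣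
∣p∪q∣≤∣p∣+∣q∣ []            []            = z≤n
∣p∪q∣≤∣p∣+∣q∣ (outside ∷ p) (outside ∷ q) = ∣p∪q∣≤∣p∣+∣q∣ p q
∣p∪q∣≤∣p∣+∣q∣ (outside ∷ p) (inside ∷ q)  =
  ℕₚ.≤-trans (s≤s (∣p∪q∣≤∣p∣+∣q∣ p q)) (ℕₚ.≤-reflexive (sym (ℕₚ.+-suc ∣ p ∣ ∣ q ∣)))
∣p∪q∣≤∣p∣+∣q∣ (inside ∷ p)  (s ∷ q)       =
  s≤s (ℕₚ.≤-trans (∣p∪q∣≤∣p∣+∣q∣ p q) (ℕₚ.+-monoʳ-≤ ∣ p ∣ (∣p∣≤∣x∷p∣ s q)))

x∈p─q⇒x∉q : ∀ {m} {x : Fin m} (p q : Subset m) → x ∈ p ─ q → x ∉ q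
x∈p─q⇒x∉q (s ∷ p) (inside ∷ q) () here
x∈p─q⇒x∉q (s ∷ p) (t ∷ q) (there x∈p─q) (there x∈q) = x∈p─q⇒x∉q p q x∈p─q x∈q

x∈p─⁅y⁆⇒x≢y : ∀ {m} {x y : Fin m} {p : Subset m} → x ∈ p ─ ⁅ y ⁆ → x ≢ y
x∈p─⁅y⁆⇒x≢y {y = y} {p} x∈p─⁅y⁆ refl = x∈p─q⇒x∉q p ⁅ y ⁆ x∈p─⁅y⁆ (x∈⁅x⁆ y)

∉⇒lookup≡false : ∀ {m} {e : Fin m} {p : Subset m} → e ∉ p → lookup p e ≡ false
∉⇒lookup≡false {e = e} {p} e∉p with lookup p e in eq
... | true  = ⊥-elim (e∉p (lookup⇒[]= e p eq))
... | false = refl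

lookup≡false⇒∉ : ∀ {m} {e : Fin m} {p : Subset m} → lookup p e ≡ false → e ∉ p
lookup≡false⇒∉ eq e∈p = case trans (sym eq) ([]=⇒lookup e∈p) of λ ()

exchange : ∀ {m} → Subset m → Fin m → Fin m → Subset m
exchange T g h = (T ─ ⁅ g ⁆) Subset.∪ ⁅ h ⁆

module _ {m : ℕ} {T : Subset m} {g h : Fin m} where

  ∈-exchange⁻ : ∀ {f} → f ∈ exchange T g h → f ≡ h ⊎ (f ∈ T × f ≢ g)
  ∈-exchange⁻ f∈ with x∈p∪q⁻ (T ─ ⁅ g ⁆) ⁅ h ⁆ f∈
  ... | inj₁ f∈T-g = inj₂ (p─q⊆p T ⁅ g ⁆ f∈T-g , x∈p─⁅y⁆⇒x≢y f∈T-g)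
  ... | inj₂ f∈⁅h⁆ = inj₁ (x∈⁅y⁆⇒x≡y h f∈⁅h⁆)

  ∈-exchange⁺ : ∀ {f} → f ∈ T → f ≢ g → f ∈ exchange T g h
  ∈-exchange⁺ f∈T f≢g = x∈p∪q⁺ (inj₁ (x∈p∧x≢y⇒x∈p-y f∈T f≢g))

  h∈exchange : h ∈ exchange T g h
  h∈exchange = x∈p∪q⁺ (inj₂ (x∈⁅x⁆ h))

  module _ {A : Subset m} where

    exchange-∩-⊆ : exchange T g h ∩ A ⊆ₛ ((T ∩ A) ─ ⁅ g ⁆) Subset.∪ ⁅ h ⁆
    exchange-∩-⊆ f∈ with x∈p∩q⁻ (exchange T g h) A f∈
    ... | f∈ex , f∈A with ∈-exchange⁻ f∈ex
    ...   | inj₁ refl          = x∈p∪q⁺ (inj₂ (x∈⁅x⁆ h))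
    ...   | inj₂ (f∈T , f≢g)   = x∈p∪q⁺ (inj₁ (x∈p∧x≢y⇒x∈p-y (x∈p∩q⁺ (f∈T , f∈A)) f≢g))

    exchange-∩-⊆-∉ : h ∉ A → exchange T g h ∩ A ⊆ₛ (T ∩ A) ─ ⁅ g ⁆
    exchange-∩-⊆-∉ h∉A f∈ with x∈p∩q⁻ (exchange T g h) A f∈
    ... | f∈ex , f∈A with ∈-exchange⁻ f∈ex
    ...   | inj₁ refl          = ⊥-elim (h∉A f∈A)
    ...   | inj₂ (f∈T , f≢g)   = x∈p∧x≢y⇒x∈p-y (x∈p∩q⁺ (f∈T , f∈A)) f≢g

    ∣exchange∩∣<∣∩∣ : g ∈ T → g ∈ A → h ∉ A → ∣ exchange T g h ∩ A ∣ ℕ.< ∣ T ∩ A ∣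
    ∣exchange∩∣<∣∩∣ g∈T g∈A h∉A =
      ℕₚ.≤-<-trans (p⊆q⇒∣p∣≤∣q∣ (exchange-∩-⊆-∉ h∉A)) (x∈p⇒∣p-x∣<∣p∣ (x∈p∩q⁺ (g∈T , g∈A)))

    ∣exchange∩∣≤∣∩∣ : g ∈ T → g ∈ A ⊎ h ∉ A → ∣ exchange T g h ∩ A ∣ ℕ.≤ ∣ T ∩ A ∣
    ∣exchange∩∣≤∣∩∣ g∈T (inj₂ h∉A) =
      ℕₚ.≤-trans (p⊆q⇒∣p∣≤∣q∣ (exchange-∩-⊆-∉ h∉A)) (∣p─q∣≤∣p∣ (T ∩ A) ⁅ g ⁆)
    ∣exchange∩∣≤∣∩∣ g∈T (inj₁ g∈A) = begin
      ∣ exchange T g h ∩ A ∣                ≤⟨ p⊆q⇒∣p∣≤∣q∣ exchange-∩-⊆ ⟩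
      ∣ ((T ∩ A) ─ ⁅ g ⁆) Subset.∪ ⁅ h ⁆ ∣  ≤⟨ ∣p∪q∣≤∣p∣+∣q∣ ((T ∩ A) ─ ⁅ g ⁆) ⁅ h ⁆ ⟩
      ∣ (T ∩ A) ─ ⁅ g ⁆ ∣ ℕ.+ ∣ ⁅ h ⁆ ∣     ≡⟨ cong (∣ (T ∩ A) ─ ⁅ g ⁆ ∣ ℕ.+_) (∣⁅x⁆∣≡1 h) ⟩
      ∣ (T ∩ A) ─ ⁅ g ⁆ ∣ ℕ.+ 1             ≡⟨ ℕₚ.+-comm ∣ (T ∩ A) ─ ⁅ g ⁆ ∣ 1 ⟩
      suc ∣ (T ∩ A) ─ ⁅ g ⁆ ∣               ≤⟨ x∈p⇒∣p-x∣<∣p∣ (x∈p∩q⁺ (g∈T , g∈A)) ⟩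
      ∣ T ∩ A ∣                             ∎
      where open ℕₚ.≤-Reasoning

module _ {n m : ℕ} {G : Multigraph n m} {T : Subset m} {g h : Fin m}
         (T-tree : SpanningTree G T) (¬h : ¬ Reach G ((_∈ T) ∖｛ g ｝) (src G h) (tgt G h)) where

  private
    T′ : Subset m
    T′ = exchange T g h
    T∖g : EdgeSet m
    T∖g = (_∈ T) ∖｛ g ｝

    T∖g⊆T′ : T∖g ⊆ (_∈ T′)
    T∖g⊆T′ (f∈T , f≢g) = ∈-exchange⁺ f∈T f≢g

    split : ∀ u w → Reach G T∖g u w ⊎ Via G T∖g g u w
    split u w = Reach-split g (Reach-mono inj₁ (tree-connects T-tree u w))

    side : ∀ u → Reach G T∖g (src G g) u ⊎ Reach G T∖g (tgt G g) u
    side u with split (src G g) u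
    ... | inj₁ a              = inj₁ a
    ... | inj₂ (inj₁ (_ , b)) = inj₂ b
    ... | inj₂ (inj₂ (_ , b)) = inj₁ b

    g-ends : Reach G (_∈ T′) (src G g) (tgt G g)
    g-ends with side (src G h) | side (tgt G h)
    ... | inj₁ a | inj₁ b = ⊥-elim (¬h (Reach-trans (Reach-sym a) b))
    ... | inj₂ a | inj₂ b = ⊥-elim (¬h (Reach-trans (Reach-sym a) b))
    ... | inj₁ a | inj₂ b = Reach-trans (Reach-mono T∖g⊆T′ a) (Reach-trans (fwd h h∈exchange here) (Reach-mono T∖g⊆T′ (Reach-sym b)))
    ... | inj₂ a | inj₁ b = Reach-trans (Reach-mono T∖g⊆T′ b) (Reach-trans (bwd h h∈exchange here) (Reach-mono T∖g⊆T′ (Reach-sym a)))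

  exchange-connects : ∀ u w → Reach G (_∈ exchange T g h) u w
  exchange-connects u w = [ Reach-mono T∖g⊆T′ , Via-join g-ends ∘ Via-mono T∖g⊆T′ ]′ (split u w)

  exchange-acyclic : Acyclic G (exchange T g h)
  exchange-acyclic e e∈T′ r with ∈-exchange⁻ e∈T′
  ... | inj₁ refl = ¬h (Reach-mono avoid-h r)
    where
    avoid-h : (_∈ T′) ∖｛ h ｝ ⊆ T∖g
    avoid-h (f∈T′ , f≢h) = [ ⊥-elim ∘ f≢h , id ]′ (∈-exchange⁻ f∈T′)
  ... | inj₂ (e∈T , e≢g) = [ tree-acyclic T-tree e e∈T ∘ Reach-mono old , ¬h ∘ close ]′ (Reach-split h (Reach-mono cases r))
    where
    cases : (_∈ T′) ∖｛ e ｝ ⊆ (T∖g ∖｛ e ｝) ∪ (_≡ h)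
    cases (f∈T′ , f≢e) = Sum.map₁ (λ p → p , f≢e) (Sum.swap (∈-exchange⁻ f∈T′))
    old : (T∖g ∖｛ e ｝) ∖｛ h ｝ ⊆ (_∈ T) ∖｛ e ｝
    old (((f∈T , _) , f≢e) , _) = f∈T , f≢e
    close : Via G ((T∖g ∖｛ e ｝) ∖｛ h ｝) h (src G e) (tgt G e) → Reach G T∖g (src G h) (tgt G h)
    close via = Via-cycle (Via-mono (proj₁ ∘ proj₁) via) (fwd e (e∈T , e≢g) here)

  exchange-spanningTree : SpanningTree G (exchange T g h)
  exchange-spanningTree = spanningTree exchange-connects exchange-acyclic

-- Spanning trees meeting an edge set in as few edges as possible

module _ {n m : ℕ} (G : Multigraph n m) where

  SpansComplement : Subset m → Subset m → Set
  SpansComplement A γ = ∀ f → f ∉ A → Reach G (λ e → e ∈ γ × e ∉ A) (src G f) (tgt G f)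

  MeetsMinimally : Subset m → Subset m → Set
  MeetsMinimally A γ = ∀ γ′ → SpanningTree G γ′ → ∣ γ ∩ A ∣ ℕ.≤ ∣ γ′ ∩ A ∣

module _ {n m : ℕ} {G : Multigraph n m} where

  spanningTree-⊆⇒⊇ : ∀ {γ γ₀} → SpanningTree G γ → SpanningTree G γ₀ → γ₀ ⊆ₛ γ → γ ⊆ₛ γ₀
  spanningTree-⊆⇒⊇ {γ} {γ₀} γ-tree γ₀-tree γ₀⊆γ {e} e∈γ with e ∈? γ₀
  ... | yes e∈γ₀ = e∈γ₀
  ... | no e∉γ₀  = ⊥-elim (tree-acyclic γ-tree e e∈γ
                     (Reach-mono (λ f∈γ₀ → γ₀⊆γ f∈γ₀ , λ { refl → e∉γ₀ f∈γ₀ }) (tree-connects γ₀-tree _ _)))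

  fundamental-exchange : ∀ {A γ f} → SpanningTree G γ → f ∉ A →
                         ¬ Reach G (λ e → e ∈ γ × e ∉ A) (src G f) (tgt G f) →
                         ∃ λ g → g ∈ γ × g ∈ A × f ∉ γ × SpanningTree G (exchange γ g f)
  fundamental-exchange {A} {γ} {f} γ-tree f∉A ¬r
    with tree-cut (tree-acyclic γ-tree) (λ e → (e ∈? γ) ×-dec ¬? (e ∈? A)) proj₁ (tree-connects γ-tree _ _) ¬r
  ... | g , g∈γ , ¬outside , ¬g = g , g∈γ , g∈A , f∉γ , exchange-spanningTree γ-tree ¬g
    where
    g∈A : g ∈ A
    g∈A = decidable-stable (g ∈? A) (λ g∉A → ¬outside (g∈γ , g∉A))
    f∉γ : f ∉ γ
    f∉γ f∈γ = ¬r (fwd f (f∈γ , f∉A) here)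

  minimal⇒spansComplement : ∀ {A γ} → SpanningTree G γ → MeetsMinimally G A γ → SpansComplement G A γ
  minimal⇒spansComplement {A} {γ} γ-tree minimal f f∉A
    with Reach? (λ e → (e ∈? γ) ×-dec ¬? (e ∈? A)) (src G f) (tgt G f)
  ... | yes r = r
  ... | no ¬r with fundamental-exchange γ-tree f∉A ¬r
  ...   | g , g∈γ , g∈A , _ , tree = ⊥-elim (ℕₚ.<⇒≱ (∣exchange∩∣<∣∩∣ g∈γ g∈A f∉A) (minimal _ tree))

  -- Induction on ∣ γ₀ ∖ γ ∣: an edge g ∈ γ₀ ∖ γ is exchanged for an edge h ∈ γ across the cut
  -- of γ₀ - g, chosen outside A whenever g ∉ A, so that γ₀ meets A in no more edges than before.
  spansComplement⇒minimal : ∀ {A γ} → SpanningTree G γ → SpansComplement G A γ → MeetsMinimally G A γ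
  spansComplement⇒minimal {A} {γ} γ-tree spans γ₀ γ₀-tree = go γ₀ γ₀-tree (<-wellFounded _)
    where
    go : ∀ γ₀ → SpanningTree G γ₀ → Acc ℕ._<_ ∣ γ₀ ∩ ∁ γ ∣ → ∣ γ ∩ A ∣ ℕ.≤ ∣ γ₀ ∩ A ∣
    go γ₀ γ₀-tree (acc smaller) with any? (λ g → (g ∈? γ₀) ×-dec ¬? (g ∈? γ))
    ... | no ¬new = p⊆q⇒∣p∣≤∣q∣ (λ e∈ → let e∈γ , e∈A = x∈p∩q⁻ γ A e∈ in x∈p∩q⁺ (γ⊆γ₀ e∈γ , e∈A))
      where
      γ₀⊆γ : γ₀ ⊆ₛ γ
      γ₀⊆γ {e} e∈γ₀ = decidable-stable (e ∈? γ) (λ e∉γ → ¬new (e , e∈γ₀ , e∉γ))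
      γ⊆γ₀ : γ ⊆ₛ γ₀
      γ⊆γ₀ = spanningTree-⊆⇒⊇ γ-tree γ₀-tree γ₀⊆γ
    ... | yes (g , g∈γ₀ , g∉γ) = swap-in crossing
      where
      ¬g : ¬ Reach G ((_∈ γ₀) ∖｛ g ｝) (src G g) (tgt G g)
      ¬g = tree-acyclic γ₀-tree g g∈γ₀
      γ₀∖g? : Decidable ((_∈ γ₀) ∖｛ g ｝)
      γ₀∖g? e = (e ∈? γ₀) ×-dec ¬? (e ≟ g)
      crossing : ∃ λ h → h ∈ γ × (g ∈ A ⊎ h ∉ A) × ¬ Reach G ((_∈ γ₀) ∖｛ g ｝) (src G h) (tgt G h)
      crossing with g ∈? A
      ... | yes g∈A = let h , h∈γ , ¬h = crossing-edge γ₀∖g? (tree-connects γ-tree _ _) ¬g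
                      in h , h∈γ , inj₁ g∈A , ¬h
      ... | no g∉A  = let h , (h∈γ , h∉A) , ¬h = crossing-edge γ₀∖g? (spans g g∉A) ¬g
                      in h , h∈γ , inj₂ h∉A , ¬h
      swap-in : (∃ λ h → h ∈ γ × (g ∈ A ⊎ h ∉ A) × ¬ Reach G ((_∈ γ₀) ∖｛ g ｝) (src G h) (tgt G h)) →
                ∣ γ ∩ A ∣ ℕ.≤ ∣ γ₀ ∩ A ∣
      swap-in (h , h∈γ , g∈A⊎h∉A , ¬h) =
        ℕₚ.≤-trans (go (exchange γ₀ g h) (exchange-spanningTree γ₀-tree ¬h)
                       (smaller (∣exchange∩∣<∣∩∣ g∈γ₀ (x∉p⇒x∈∁p g∉γ) (x∈p⇒x∉∁p h∈γ))))
                   (∣exchange∩∣≤∣∩∣ g∈γ₀ g∈A⊎h∉A)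

-- Replacing the part of a spanning tree inside a component

Induced : ∀ {n m} → Multigraph n m → (Fin n → Set) → EdgeSet m
Induced G V e = V (src G e) × V (tgt G e)

splice : ∀ {m} {E : EdgeSet m} → Decidable E → Subset m → Subset m → Subset m
splice E? γ S = tabulate (λ e → if does (E? e) then lookup S e else lookup γ e)

module Splice {m : ℕ} {E : EdgeSet m} (E? : Decidable E) (γ S : Subset m) where

  lookup-splice : ∀ e → lookup (splice E? γ S) e ≡ (if does (E? e) then lookup S e else lookup γ e)
  lookup-splice = lookup∘tabulate _

  ∈-splice⁻ : ∀ {e} → e ∈ splice E? γ S → (E e × e ∈ S) ⊎ (¬ E e × e ∈ γ)
  ∈-splice⁻ {e} e∈ with E? e | trans (sym (lookup-splice e)) ([]=⇒lookup e∈)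
  ... | yes ee | e∈S = inj₁ (ee , lookup⇒[]= e S e∈S)
  ... | no ¬ee | e∈γ = inj₂ (¬ee , lookup⇒[]= e γ e∈γ)

  ∈-splice-inside : ∀ {e} → E e → e ∈ S → e ∈ splice E? γ S
  ∈-splice-inside {e} ee e∈S with E? e | lookup-splice e
  ... | yes _  | eq = lookup⇒[]= e _ (trans eq ([]=⇒lookup e∈S))
  ... | no ¬ee | _  = ⊥-elim (¬ee ee)

  ∈-splice-outside : ∀ {e} → ¬ E e → e ∈ γ → e ∈ splice E? γ S
  ∈-splice-outside {e} ¬ee e∈γ with E? e | lookup-splice e
  ... | yes ee | _  = ⊥-elim (¬ee ee)
  ... | no _   | eq = lookup⇒[]= e _ (trans eq ([]=⇒lookup e∈γ))

Induced? : ∀ {n m} (G : Multigraph n m) {V : Fin n → Set} → Decidable V → Decidable (Induced G V)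
Induced? G V? e = V? (src G e) ×-dec V? (tgt G e)

module _ {n m : ℕ} {G : Multigraph n m} {V : Fin n → Set} (V? : Decidable V) {γ S : Subset m}
         (γ-tree : SpanningTree G γ) (γ-spans-V : ∀ {u w} → V u → V w → Reach G (λ e → e ∈ γ × Induced G V e) u w)
         (S-tree : SpanningTreeOn G V S) where

  private
    T : Subset m
    T = splice (Induced? G V?) γ S
    open Splice (Induced? G V?) γ S

    Outer : EdgeSet m
    Outer e = e ∈ γ × ¬ Induced G V e

    outer-trivial : ∀ {x y} → V x → V y → Reach G Outer x y → x ≡ y
    outer-trivial vx vy r =
      acyclic-disjoint-walks (tree-acyclic γ-tree) proj₁ proj₁ (λ (_ , ¬i) (_ , i) → ¬i i) r (γ-spans-V vx vy)

    -- Outer edges of γ join no two distinct vertices of V, so a walk in the splice that avoids e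
    -- is an S-walk inside V followed by an outer γ-walk.
    Detour : Fin m → Fin n → Set
    Detour e w = ∃ λ x → V x × Reach G ((_∈ S) ∖｛ e ｝) (src G e) x × Reach G Outer x w

    detour : ∀ {e w} → Induced G V e → Reach G ((_∈ T) ∖｛ e ｝) (src G e) w → Detour e w
    detour ie here = _ , proj₁ ie , here , here
    detour ie (fwd f (f∈T , f≢e) r) with detour ie r | ∈-splice⁻ f∈T
    ... | x , vx , a , b | inj₁ (if , f∈S) =
      _ , proj₂ if , fwd f (f∈S , f≢e) (subst (Reach G _ _) (outer-trivial vx (proj₁ if) b) a) , here
    ... | x , vx , a , b | inj₂ (¬if , f∈γ) = x , vx , a , fwd f (f∈γ , ¬if) b
    detour ie (bwd f (f∈T , f≢e) r) with detour ie r | ∈-splice⁻ f∈T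
    ... | x , vx , a , b | inj₁ (if , f∈S) =
      _ , proj₁ if , bwd f (f∈S , f≢e) (subst (Reach G _ _) (outer-trivial vx (proj₂ if) b) a) , here
    ... | x , vx , a , b | inj₂ (¬if , f∈γ) = x , vx , a , bwd f (f∈γ , ¬if) b

  splice-connects : ∀ u w → Reach G (_∈ splice (Induced? G V?) γ S) u w
  splice-connects u w = Reach-bind step (tree-connects γ-tree u w)
    where
    step : ∀ {f} → f ∈ γ → Reach G (_∈ T) (src G f) (tgt G f)
    step {f} f∈γ with Induced? G V? f
    ... | yes (vs , vt) = Reach-mono (λ {e} e∈S → ∈-splice-inside (proj₁ S-tree e e∈S) e∈S) (proj₁ (proj₂ S-tree) _ _ vs vt)
    ... | no ¬i         = fwd f (∈-splice-outside ¬i f∈γ) here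

  splice-acyclic : Acyclic G (splice (Induced? G V?) γ S)
  splice-acyclic e e∈T r with ∈-splice⁻ e∈T
  ... | inj₁ (ie , e∈S) with detour ie r
  ...   | x , vx , a , b = proj₂ (proj₂ S-tree) e e∈S (subst (Reach G _ _) (outer-trivial vx (proj₂ ie) b) a)
  splice-acyclic e e∈T r | inj₂ (¬ie , e∈γ) = tree-acyclic γ-tree e e∈γ (Reach-bind step r)
    where
    step : ∀ {f} → ((_∈ T) ∖｛ e ｝) f → Reach G ((_∈ γ) ∖｛ e ｝) (src G f) (tgt G f)
    step {f} (f∈T , f≢e) with ∈-splice⁻ f∈T
    ... | inj₁ (if , _)  = Reach-mono (λ (g∈γ , ig) → g∈γ , λ { refl → ¬ie ig }) (γ-spans-V (proj₁ if) (proj₂ if))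
    ... | inj₂ (_ , f∈γ) = fwd f (f∈γ , f≢e) here

  splice-spanningTree : SpanningTree G (splice (Induced? G V?) γ S)
  splice-spanningTree = spanningTree splice-connects splice-acyclic

module _ {n m : ℕ} {G : Multigraph n m} {J : Subset m} {v : Fin n} where

  private
    V : Fin n → Set
    V = Reach G (λ e → e ∉ J) v

  component-spanned : ∀ {γ} → SpansComplement G J γ → ∀ {u w} → V u → V w →
                      Reach G (λ e → e ∈ γ × Induced G V e) u w
  component-spanned {γ} spans vu vw =
    Reach-trans (Reach-sym (proj₂ (stay here (Reach-bind (λ {f} → spans f) vu))))
                (proj₂ (stay here (Reach-bind (λ {f} → spans f) vw)))
    where
    stay : ∀ {x y} → V x → Reach G (λ e → e ∈ γ × e ∉ J) x y → V y × Reach G (λ e → e ∈ γ × Induced G V e) x y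
    stay vx here = vx , here
    stay vx (fwd e (e∈γ , e∉J) r) with stay vx r
    ... | vs , r′ = fwd e e∉J vs , fwd e (e∈γ , vs , fwd e e∉J vs) r′
    stay vx (bwd e (e∈γ , e∉J) r) with stay vx r
    ... | vt , r′ = bwd e e∉J vt , bwd e (e∈γ , bwd e e∉J vt , vt) r′

-- Finite sums of rationals

∑ : ∀ {A : Set} → List A → (A → ℚ) → ℚ
∑ xs f = sumℚ (map f xs)

infixr 8 ∑
syntax ∑ xs (λ x → e) = ∑[ x ∈ xs ] e

module _ {A : Set} where

  ∑-cong : ∀ (xs : List A) {f g : A → ℚ} → (∀ x → f x ≡ g x) → ∑ xs f ≡ ∑ xs g
  ∑-cong []       f≗g = refl
  ∑-cong (x ∷ xs) f≗g = cong₂ _+_ (f≗g x) (∑-cong xs f≗g)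

  ∑-0 : ∀ (xs : List A) → ∑[ x ∈ xs ] 0ℚ ≡ 0ℚ
  ∑-0 []       = refl
  ∑-0 (x ∷ xs) = trans (ℚ.+-identityˡ _) (∑-0 xs)

  ∑-+ : ∀ (xs : List A) (f g : A → ℚ) → ∑[ x ∈ xs ] (f x + g x) ≡ ∑ xs f + ∑ xs g
  ∑-+ []       f g = refl
  ∑-+ (x ∷ xs) f g = trans (cong (f x + g x +_) (∑-+ xs f g)) (interchange (f x) (g x) (∑ xs f) (∑ xs g))
    where
    open ℚ-Solver
    interchange : ∀ a b c d → (a + b) + (c + d) ≡ (a + c) + (b + d)
    interchange = solve 4 (λ a b c d → (a :+ b) :+ (c :+ d) := (a :+ c) :+ (b :+ d)) refl

  ∑-*ˡ : ∀ (xs : List A) (c : ℚ) (f : A → ℚ) → ∑[ x ∈ xs ] (c * f x) ≡ c * ∑ xs f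
  ∑-*ˡ []       c f = sym (ℚ.*-zeroʳ c)
  ∑-*ˡ (x ∷ xs) c f = trans (cong (c * f x +_) (∑-*ˡ xs c f)) (sym (ℚ.*-distribˡ-+ c (f x) _))

  ∑-*ʳ : ∀ (xs : List A) (c : ℚ) (f : A → ℚ) → ∑[ x ∈ xs ] (f x * c) ≡ ∑ xs f * c
  ∑-*ʳ xs c f = trans (∑-cong xs (λ x → ℚ.*-comm (f x) c)) (trans (∑-*ˡ xs c f) (ℚ.*-comm c _))

  ∑-minus : ∀ (xs : List A) (f g : A → ℚ) → ∑[ x ∈ xs ] (f x - g x) ≡ ∑ xs f - ∑ xs g
  ∑-minus []       f g = refl
  ∑-minus (x ∷ xs) f g = trans (cong (f x - g x +_) (∑-minus xs f g)) (interchange (f x) (g x) (∑ xs f) (∑ xs g))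
    where
    open ℚ-Solver
    interchange : ∀ a b c d → (a - b) + (c - d) ≡ (a + c) - (b + d)
    interchange = solve 4 (λ a b c d → (a :- b) :+ (c :- d) := (a :+ c) :- (b :+ d)) refl

  ∑-mono-≤ : ∀ (xs : List A) {f g : A → ℚ} → (∀ x → f x ≤ g x) → ∑ xs f ≤ ∑ xs g
  ∑-mono-≤ []       f≤g = ℚ.≤-refl
  ∑-mono-≤ (x ∷ xs) f≤g = ℚ.+-mono-≤ (f≤g x) (∑-mono-≤ xs f≤g)

  ∑-nonNeg : ∀ (xs : List A) {f : A → ℚ} → (∀ x → 0ℚ ≤ f x) → 0ℚ ≤ ∑ xs f
  ∑-nonNeg xs 0≤f = subst (_≤ ∑ xs _) (∑-0 xs) (∑-mono-≤ xs 0≤f)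

  ∑≢0⇒∃≢0 : ∀ (xs : List A) (f : A → ℚ) → ∑ xs f ≢ 0ℚ → ∃ λ x → f x ≢ 0ℚ
  ∑≢0⇒∃≢0 []       f ∑≢0 = ⊥-elim (∑≢0 refl)
  ∑≢0⇒∃≢0 (x ∷ xs) f ∑≢0 with f x ℚ.≟ 0ℚ
  ... | no fx≢0   = x , fx≢0
  ... | yes fx≡0  = ∑≢0⇒∃≢0 xs f (λ ∑≡0 → ∑≢0 (cong₂ _+_ fx≡0 ∑≡0))

  ∑-nonNeg≤0⇒0 : ∀ (xs : List A) {f : A → ℚ} → (∀ x → 0ℚ ≤ f x) → ∑ xs f ≤ 0ℚ → ∀ {x} → x ∈ₗ xs → f x ≡ 0ℚ
  ∑-nonNeg≤0⇒0 (y ∷ xs) {f} 0≤f ∑≤0 (here refl) =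
    ℚ.≤-antisym (ℚ.≤-trans (subst (_≤ f y + ∑ xs f) (ℚ.+-identityʳ (f y)) (ℚ.+-monoʳ-≤ (f y) (∑-nonNeg xs 0≤f))) ∑≤0) (0≤f y)
  ∑-nonNeg≤0⇒0 (y ∷ xs) {f} 0≤f ∑≤0 (there x∈xs) =
    ∑-nonNeg≤0⇒0 xs 0≤f (ℚ.≤-trans (subst (_≤ f y + ∑ xs f) (ℚ.+-identityˡ _) (ℚ.+-monoˡ-≤ (∑ xs f) (0≤f y))) ∑≤0) x∈xs

  ∑-++ : ∀ (xs ys : List A) (f : A → ℚ) → ∑ (xs ++ ys) f ≡ ∑ xs f + ∑ ys f
  ∑-++ []       ys f = sym (ℚ.+-identityˡ _)
  ∑-++ (x ∷ xs) ys f = trans (cong (f x +_) (∑-++ xs ys f)) (sym (ℚ.+-assoc (f x) _ _))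

∑-swap : ∀ {A B : Set} (xs : List A) (ys : List B) (f : A → B → ℚ) →
         ∑[ x ∈ xs ] ∑[ y ∈ ys ] f x y ≡ ∑[ y ∈ ys ] ∑[ x ∈ xs ] f x y
∑-swap []       ys f = sym (∑-0 ys)
∑-swap (x ∷ xs) ys f = trans (cong (∑ ys (f x) +_) (∑-swap xs ys f)) (sym (∑-+ ys (f x) _))

∑-map : ∀ {A B : Set} (g : B → A) (ys : List B) (f : A → ℚ) → ∑ (map g ys) f ≡ ∑[ y ∈ ys ] f (g y)
∑-map g ys f = cong sumℚ (sym (map-∘ ys))

∑-allFin-suc : ∀ {m} (f : Fin (suc m) → ℚ) → ∑ (allFin (suc m)) f ≡ f zero + ∑[ e ∈ allFin m ] f (suc e)
∑-allFin-suc {m} f = cong (λ xs → f zero + sumℚ xs) (trans (map-tabulate suc f) (sym (map-tabulate id (f ∘ suc))))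

∑-allFin-point : ∀ {m} (x : Fin m) (c : ℚ) → ∑[ e ∈ allFin m ] (if does (e ≟ x) then c else 0ℚ) ≡ c
∑-allFin-point {suc m} zero c =
  trans (∑-allFin-suc {m} (λ e → if does (e ≟ zero) then c else 0ℚ)) (trans (cong (c +_) (∑-0 (allFin m))) (ℚ.+-identityʳ c))
∑-allFin-point {suc m} (suc x) c =
  trans (∑-allFin-suc {m} (λ e → if does (e ≟ suc x) then c else 0ℚ)) (trans (ℚ.+-identityˡ _) (∑-allFin-point x c))

_≟ₛ_ : ∀ {m} → DecidableEquality (Subset m)
_≟ₛ_ = ≡-dec Bool._≟_

∈-allSubsets : ∀ {m} (T : Subset m) → T ∈ₗ allSubsets m
∈-allSubsets []                    = here refl
∈-allSubsets {suc m} (inside ∷ T)  = ∈-++⁺ˡ (∈-map⁺ (inside ∷_) (∈-allSubsets T))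
∈-allSubsets {suc m} (outside ∷ T) = ∈-++⁺ʳ (map (inside ∷_) (allSubsets m)) (∈-map⁺ (outside ∷_) (∈-allSubsets T))

∑-allSubsets-point : ∀ {m} (X : Subset m) (c : ℚ) → ∑[ T ∈ allSubsets m ] (if does (T ≟ₛ X) then c else 0ℚ) ≡ c
∑-allSubsets-point [] c = ℚ.+-identityʳ c
∑-allSubsets-point {suc m} (x ∷ X) c = begin
  ∑ (map (inside ∷_) L ++ map (outside ∷_) L) F        ≡⟨ ∑-++ (map (inside ∷_) L) _ F ⟩
  ∑ (map (inside ∷_) L) F + ∑ (map (outside ∷_) L) F  ≡⟨ cong₂ _+_ (∑-map (inside ∷_) L F) (∑-map (outside ∷_) L F) ⟩
  ∑[ T ∈ L ] F (inside ∷ T) + ∑[ T ∈ L ] F (outside ∷ T) ≡⟨ split x ⟩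
  c                                                      ∎
  where
  open ≡-Reasoning
  L : List (Subset m)
  L = allSubsets m
  F : Subset (suc m) → ℚ
  F T = if does (T ≟ₛ (x ∷ X)) then c else 0ℚ
  split : ∀ x → ∑[ T ∈ L ] (if does ((inside ∷ T) ≟ₛ (x ∷ X)) then c else 0ℚ) +
                ∑[ T ∈ L ] (if does ((outside ∷ T) ≟ₛ (x ∷ X)) then c else 0ℚ) ≡ c
  split inside  = trans (cong₂ _+_ (∑-allSubsets-point X c) (∑-0 L)) (ℚ.+-identityʳ c)
  split outside = trans (cong₂ _+_ (∑-0 L) (∑-allSubsets-point X c)) (ℚ.+-identityˡ c)

*-nonNeg : ∀ {a b} → 0ℚ ≤ a → 0ℚ ≤ b → 0ℚ ≤ a * b
*-nonNeg {a} {b} 0≤a 0≤b = ℚ.nonNegative⁻¹ (a * b) {{ℚ.nonNeg*nonNeg⇒nonNeg a {{nonNegative 0≤a}} b {{nonNegative 0≤b}}}}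

*-pos : ∀ {a b} → 0ℚ < a → 0ℚ < b → 0ℚ < a * b
*-pos {a} {b} 0<a 0<b = ℚ.positive⁻¹ (a * b) {{ℚ.pos*pos⇒pos a {{positive 0<a}} b {{positive 0<b}}}}

p≤q⇒0≤q-p : ∀ {p q} → p ≤ q → 0ℚ ≤ q - p
p≤q⇒0≤q-p {p} {q} p≤q = subst (_≤ q - p) (ℚ.+-inverseʳ p) (ℚ.+-monoˡ-≤ (- p) p≤q)

0≤q-p⇒p≤q : ∀ {p q} → 0ℚ ≤ q - p → p ≤ q
0≤q-p⇒p≤q {p} {q} 0≤q-p = subst₂ _≤_ (ℚ.+-identityʳ p) (solve 2 (λ p q → p :+ (q :- p) := q) refl p q) (ℚ.+-monoʳ-≤ p 0≤q-p)
  where open ℚ-Solver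

p≤q⇒p-q≤0 : ∀ {p q} → p ≤ q → p - q ≤ 0ℚ
p≤q⇒p-q≤0 {p} {q} p≤q = subst (p - q ≤_) (ℚ.+-inverseʳ q) (ℚ.+-monoˡ-≤ (- q) p≤q)

p-q≤0⇒p≤q : ∀ {p q} → p - q ≤ 0ℚ → p ≤ q
p-q≤0⇒p≤q {p} {q} p-q≤0 = subst₂ _≤_ (solve 2 (λ p q → (p :- q) :+ q := p) refl p q) (ℚ.+-identityˡ q) (ℚ.+-monoˡ-≤ q p-q≤0)
  where open ℚ-Solver

≤∧≢⇒< : ∀ {p q} → p ≤ q → p ≢ q → p < q
≤∧≢⇒< {p} {q} p≤q p≢q with ℚ.<-cmp p q
... | tri< p<q _ _ = p<q
... | tri≈ _ p≡q _ = ⊥-elim (p≢q p≡q)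
... | tri> _ _ q<p = ⊥-elim (ℚ.<-irrefl refl (ℚ.<-≤-trans q<p p≤q))

-- Repeated addition of 1ℚ, following the recursion of ∣_∣.
fromℕ : ℕ → ℚ
fromℕ zero    = 0ℚ
fromℕ (suc k) = 1ℚ + fromℕ k

fromℕ-nonNeg : ∀ k → 0ℚ ≤ fromℕ k
fromℕ-nonNeg zero    = ℚ.≤-refl
fromℕ-nonNeg (suc k) = ℚ.+-mono-≤ (ℚ.<⇒≤ (ℚ.positive⁻¹ 1ℚ)) (fromℕ-nonNeg k)

fromℕ-pos : ∀ k → 0ℚ < fromℕ (suc k)
fromℕ-pos k = ℚ.+-mono-<-≤ (ℚ.positive⁻¹ 1ℚ) (fromℕ-nonNeg k)

fromℕ-mono-≤ : ∀ {a b} → a ℕ.≤ b → fromℕ a ≤ fromℕ b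
fromℕ-mono-≤ {b = b} z≤n = fromℕ-nonNeg b
fromℕ-mono-≤ (s≤s a≤b)   = ℚ.+-monoʳ-≤ 1ℚ (fromℕ-mono-≤ a≤b)

fromℕ-cancel-≤ : ∀ a b → fromℕ a ≤ fromℕ b → a ℕ.≤ b
fromℕ-cancel-≤ zero    b       _ = z≤n
fromℕ-cancel-≤ (suc a) zero    p = ⊥-elim (ℚ.<-irrefl refl (ℚ.<-≤-trans (fromℕ-pos a) p))
fromℕ-cancel-≤ (suc a) (suc b) p = s≤s (fromℕ-cancel-≤ a b (subst₂ _≤_ (cancel (fromℕ a)) (cancel (fromℕ b)) (ℚ.+-monoʳ-≤ (- 1ℚ) p)))
  where
  open ℚ-Solver
  cancel : ∀ x → - 1ℚ + (1ℚ + x) ≡ x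
  cancel = solve 1 (λ x → :- con 1ℚ :+ (con 1ℚ :+ x) := x) refl

θval-*-fromℕ : ∀ k d → θval k (suc d) * fromℕ (suc d) ≡ fromℕ k
θval-*-fromℕ k d = ℚ.toℚᵘ-injective (begin-equality
  toℚᵘ ((ℤ.+ k / suc d) * fromℕ (suc d))           ≃⟨ ℚ.toℚᵘ-homo-* (ℤ.+ k / suc d) (fromℕ (suc d)) ⟩
  toℚᵘ (ℤ.+ k / suc d) ℚᵘ.* toℚᵘ (fromℕ (suc d))  ≃⟨ ℚᵘ.*-cong (ℚ.toℚᵘ-fromℚᵘ (mkℚᵘ (ℤ.+ k) d)) (toℚᵘ-fromℕ (suc d)) ⟩
  mkℚᵘ (ℤ.+ k) d ℚᵘ.* mkℚᵘ (ℤ.+ suc d) 0             ≃⟨ *≡* (solve 2 (λ x y → (x :* y) :* con (ℤ.+ 1) := x :* (y :* con (ℤ.+ 1))) refl (ℤ.+ k) (ℤ.+ suc d)) ⟩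
  mkℚᵘ (ℤ.+ k) 0                                   ≃⟨ ℚᵘ.≃-sym (toℚᵘ-fromℕ k) ⟩
  toℚᵘ (fromℕ k)                                 ∎)
  where
  open ℚᵘ.≤-Reasoning
  open ℤ-Solver
  toℚᵘ-fromℕ : ∀ j → toℚᵘ (fromℕ j) ℚᵘ.≃ mkℚᵘ (ℤ.+ j) 0
  toℚᵘ-fromℕ zero    = *≡* refl
  toℚᵘ-fromℕ (suc j) = ℚᵘ.≃-trans (ℚ.toℚᵘ-homo-+ 1ℚ (fromℕ j)) (ℚᵘ.≃-trans (ℚᵘ.+-cong (ℚᵘ.≃-refl {toℚᵘ 1ℚ}) (toℚᵘ-fromℕ j))
    (*≡* (solve 1 (λ x → (con (ℤ.+ 1) :* con (ℤ.+ 1) :+ x :* con (ℤ.+ 1)) :* con (ℤ.+ 1) := (con (ℤ.+ 1) :+ x) :* (con (ℤ.+ 1) :* con (ℤ.+ 1))) refl (ℤ.+ j))))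

θval-unique : ∀ {x} k c → 0 ℕ.< c → x * fromℕ c ≡ fromℕ k → x ≡ θval k c
θval-unique {x} k (suc d) _ eq = ℚ.≤-antisym (cancel (ℚ.≤-reflexive eq′)) (cancel (ℚ.≤-reflexive (sym eq′)))
  where
  instance
    _ : Positive (fromℕ (suc d))
    _ = positive (fromℕ-pos d)
  eq′ : x * fromℕ (suc d) ≡ θval k (suc d) * fromℕ (suc d)
  eq′ = trans eq (sym (θval-*-fromℕ k d))
  cancel : ∀ {p q} → p * fromℕ (suc d) ≤ q * fromℕ (suc d) → p ≤ q
  cancel = ℚ.*-cancelʳ-≤-pos (fromℕ (suc d))

≤θval⇒*fromℕ≤ : ∀ {x} k c → x ≤ θval k c → x * fromℕ c ≤ fromℕ k
≤θval⇒*fromℕ≤ {x} k zero    _ = subst (_≤ fromℕ k) (sym (ℚ.*-zeroʳ x)) (fromℕ-nonNeg k)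
≤θval⇒*fromℕ≤ {x} k (suc d) p =
  subst (x * fromℕ (suc d) ≤_) (θval-*-fromℕ k d) (ℚ.*-monoʳ-≤-nonNeg (fromℕ (suc d)) {{nonNegative (fromℕ-nonNeg (suc d))}} p)

-- Edge weights

weight : ∀ {m} → (Fin m → ℚ) → Subset m → ℚ
weight {m} w T = ∑[ e ∈ allFin m ] (if lookup T e then w e else 0ℚ)

if-true : ∀ {b} (x : ℚ) → b ≡ true → (if b then x else 0ℚ) ≡ x
if-true x refl = refl

if-false : ∀ {b} (x : ℚ) → b ≡ false → (if b then x else 0ℚ) ≡ 0ℚ
if-false x refl = refl

if-∑ : ∀ {A : Set} (b : Bool) (xs : List A) (f : A → ℚ) →
       (if b then ∑ xs f else 0ℚ) ≡ ∑[ x ∈ xs ] (if b then f x else 0ℚ)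
if-∑ true  xs f = refl
if-∑ false xs f = sym (∑-0 xs)

if-*ˡ : ∀ (b : Bool) (c x : ℚ) → (if b then c * x else 0ℚ) ≡ c * (if b then x else 0ℚ)
if-*ˡ true  c x = refl
if-*ˡ false c x = sym (ℚ.*-zeroʳ c)

weight-∷ : ∀ {m} (w : Fin (suc m) → ℚ) b (T : Subset m) →
           weight w (b ∷ T) ≡ (if b then w zero else 0ℚ) + weight (w ∘ suc) T
weight-∷ w b T = ∑-allFin-suc (λ e → if lookup (b ∷ T) e then w e else 0ℚ)

weight-const : ∀ {m} (c : ℚ) (T : Subset m) → weight (λ _ → c) T ≡ c * fromℕ ∣ T ∣
weight-const c [] = sym (ℚ.*-zeroʳ c)
weight-const c (inside ∷ T) = begin
  weight (λ _ → c) (inside ∷ T)  ≡⟨ weight-∷ (λ _ → c) inside T ⟩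
  c + weight (λ _ → c) T         ≡⟨ cong (c +_) (weight-const c T) ⟩
  c + c * fromℕ ∣ T ∣            ≡⟨ solve 2 (λ c k → c :+ c :* k := c :* (con 1ℚ :+ k)) refl c (fromℕ ∣ T ∣) ⟩
  c * fromℕ (suc ∣ T ∣)          ∎
  where open ≡-Reasoning; open ℚ-Solver
weight-const c (outside ∷ T) = trans (weight-∷ (λ _ → c) outside T) (trans (ℚ.+-identityˡ _) (weight-const c T))

weight-mono-≤ : ∀ {m} {w w′ : Fin m → ℚ} → (∀ e → w e ≤ w′ e) → ∀ T → weight w T ≤ weight w′ T
weight-mono-≤ {m} w≤w′ T = ∑-mono-≤ (allFin m) pointwise
  where
  pointwise : ∀ e → (if lookup T e then _ else 0ℚ) ≤ (if lookup T e then _ else 0ℚ)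
  pointwise e with lookup T e
  ... | true  = w≤w′ e
  ... | false = ℚ.≤-refl

weight-cong : ∀ {m} {w w′ : Fin m → ℚ} (T : Subset m) → (∀ {e} → e ∈ T → w e ≡ w′ e) → weight w T ≡ weight w′ T
weight-cong {m} T w≡w′ = ∑-cong (allFin m) pointwise
  where
  pointwise : ∀ e → (if lookup T e then _ else 0ℚ) ≡ (if lookup T e then _ else 0ℚ)
  pointwise e with lookup T e in eq
  ... | true  = w≡w′ (lookup⇒[]= e T eq)
  ... | false = refl

module _ {m : ℕ} {T : Subset m} {g h : Fin m} (g∈T : g ∈ T) (h∉T : h ∉ T) where

  lookup-exchange : ∀ {e} → e ≢ g → e ≢ h → lookup (exchange T g h) e ≡ lookup T e
  lookup-exchange {e} e≢g e≢h with lookup T e in eq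
  ... | true  = []=⇒lookup (∈-exchange⁺ (lookup⇒[]= e T eq) e≢g)
  ... | false = ∉⇒lookup≡false {p = exchange T g h} λ e∈ → [ e≢h , (λ (e∈T , _) → lookup≡false⇒∉ eq e∈T) ]′ (∈-exchange⁻ e∈)

  weight-exchange : ∀ (w : Fin m → ℚ) → weight w (exchange T g h) + w g ≡ weight w T + w h
  weight-exchange w = begin
    weight w (exchange T g h) + w g
      ≡⟨ cong (weight w (exchange T g h) +_) (sym (∑-allFin-point g (w g))) ⟩
    weight w (exchange T g h) + ∑[ e ∈ allFin m ] (if does (e ≟ g) then w g else 0ℚ)
      ≡⟨ sym (∑-+ (allFin m) _ _) ⟩
    ∑[ e ∈ allFin m ] ((if lookup (exchange T g h) e then w e else 0ℚ) + (if does (e ≟ g) then w g else 0ℚ))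
      ≡⟨ ∑-cong (allFin m) pointwise ⟩
    ∑[ e ∈ allFin m ] ((if lookup T e then w e else 0ℚ) + (if does (e ≟ h) then w h else 0ℚ))
      ≡⟨ ∑-+ (allFin m) _ _ ⟩
    weight w T + ∑[ e ∈ allFin m ] (if does (e ≟ h) then w h else 0ℚ)
      ≡⟨ cong (weight w T +_) (∑-allFin-point h (w h)) ⟩
    weight w T + w h ∎
    where
    open ≡-Reasoning
    pointwise : ∀ e → (if lookup (exchange T g h) e then w e else 0ℚ) + (if does (e ≟ g) then w g else 0ℚ) ≡
                      (if lookup T e then w e else 0ℚ) + (if does (e ≟ h) then w h else 0ℚ)
    pointwise e with e ≟ g | e ≟ h
    ... | yes refl | yes refl = ⊥-elim (h∉T g∈T)
    ... | yes e≡g | no e≢h = begin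
      (if lookup (exchange T g h) e then w e else 0ℚ) + w g ≡⟨ cong (_+ w g) (if-false (w e) e∉T′) ⟩
      0ℚ + w g                                           ≡⟨ ℚ.+-identityˡ (w g) ⟩
      w g                                                ≡⟨ cong w (sym e≡g) ⟩
      w e                                                ≡⟨ ℚ.+-identityʳ (w e) ⟨
      w e + 0ℚ                                           ≡⟨ cong (_+ 0ℚ) (if-true (w e) e∈T) ⟨
      (if lookup T e then w e else 0ℚ) + 0ℚ              ∎
      where
      e∉T′ : lookup (exchange T g h) e ≡ false
      e∉T′ = ∉⇒lookup≡false {p = exchange T g h} ([ e≢h , (λ (_ , e≢g) → e≢g e≡g) ]′ ∘ ∈-exchange⁻)
      e∈T : lookup T e ≡ true
      e∈T = []=⇒lookup (subst (_∈ T) (sym e≡g) g∈T)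
    ... | no e≢g | yes e≡h = begin
      (if lookup (exchange T g h) e then w e else 0ℚ) + 0ℚ ≡⟨ cong (_+ 0ℚ) (if-true (w e) e∈T′) ⟩
      w e + 0ℚ                                           ≡⟨ ℚ.+-identityʳ (w e) ⟩
      w e                                                ≡⟨ cong w e≡h ⟩
      w h                                                ≡⟨ ℚ.+-identityˡ (w h) ⟨
      0ℚ + w h                                           ≡⟨ cong (_+ w h) (if-false (w e) e∉T) ⟨
      (if lookup T e then w e else 0ℚ) + w h             ∎
      where
      e∈T′ : lookup (exchange T g h) e ≡ true
      e∈T′ = []=⇒lookup (subst (_∈ exchange T g h) (sym e≡h) h∈exchange)
      e∉T : lookup T e ≡ false
      e∉T = ∉⇒lookup≡false (subst (_∉ T) (sym e≡h) h∉T)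
    ... | no e≢g | no e≢h = cong (λ b → (if b then w e else 0ℚ) + 0ℚ) (lookup-exchange e≢g e≢h)

weight-usage : ∀ {m} (μ : Subset m → ℚ) (A : Subset m) →
               weight (usage μ) A ≡ ∑[ T ∈ allSubsets m ] (μ T * fromℕ ∣ T ∩ A ∣)
weight-usage {m} μ A = begin
  weight (usage μ) A
    ≡⟨ ∑-cong (allFin m) (λ e → if-∑ (lookup A e) (allSubsets m) _) ⟩
  ∑[ e ∈ allFin m ] ∑[ T ∈ allSubsets m ] (if lookup A e then (if lookup T e then μ T else 0ℚ) else 0ℚ)
    ≡⟨ ∑-swap (allFin m) (allSubsets m) _ ⟩
  ∑[ T ∈ allSubsets m ] ∑[ e ∈ allFin m ] (if lookup A e then (if lookup T e then μ T else 0ℚ) else 0ℚ)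
    ≡⟨ ∑-cong (allSubsets m) (λ T → ∑-cong (allFin m) (λ e →
         trans (nested-if (lookup A e) (lookup T e)) (cong (λ b → if b then μ T else 0ℚ) (sym (lookup-zipWith Bool._∧_ e T A))))) ⟩
  ∑[ T ∈ allSubsets m ] weight (λ _ → μ T) (T ∩ A)
    ≡⟨ ∑-cong (allSubsets m) (λ T → weight-const (μ T) (T ∩ A)) ⟩
  ∑[ T ∈ allSubsets m ] (μ T * fromℕ ∣ T ∩ A ∣) ∎
  where
  open ≡-Reasoning
  nested-if : ∀ {x} a t → (if a then (if t then x else 0ℚ) else 0ℚ) ≡ (if t Bool.∧ a then x else 0ℚ)
  nested-if true  true  = refl
  nested-if true  false = refl
  nested-if false true  = refl
  nested-if false false = refl

levelSet : ∀ {m} → (Fin m → ℚ) → ℚ → Subset m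
levelSet w t = tabulate (λ e → does (w e ℚ.≟ t))

module _ {m : ℕ} {w : Fin m → ℚ} {t : ℚ} where

  ∈-levelSet⁻ : ∀ {e} → e ∈ levelSet w t → w e ≡ t
  ∈-levelSet⁻ {e} e∈ with w e ℚ.≟ t | trans (sym (lookup∘tabulate (λ e → does (w e ℚ.≟ t)) e)) ([]=⇒lookup e∈)
  ... | yes we≡t | _ = we≡t
  ... | no _     | ()

  ∈-levelSet⁺ : ∀ {e} → w e ≡ t → e ∈ levelSet w t
  ∈-levelSet⁺ {e} we≡t with w e ℚ.≟ t | lookup∘tabulate (λ e → does (w e ℚ.≟ t)) e
  ... | yes _     | eq = lookup⇒[]= e _ eq
  ... | no we≢t   | _  = ⊥-elim (we≢t we≡t)

argmax : ∀ {k} (f : Fin (suc k) → ℚ) → ∃ λ i → ∀ j → f j ≤ f i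
argmax {zero}  f = zero , λ { zero → ℚ.≤-refl }
argmax {suc k} f with argmax (f ∘ suc)
... | i , f≤fsi with ℚ.≤-total (f zero) (f (suc i))
...   | inj₁ f0≤fsi = suc i , λ { zero → f0≤fsi ; (suc j) → f≤fsi j }
...   | inj₂ fsi≤f0 = zero  , λ { zero → ℚ.≤-refl ; (suc j) → ℚ.≤-trans (f≤fsi j) fsi≤f0 }

module _ {n m : ℕ} {G : Multigraph n m} where

  minWeight⇒spansComplement : ∀ {w t γ} → (∀ e → w e ≤ t) → SpanningTree G γ →
                              (∀ γ′ → SpanningTree G γ′ → weight w γ ≤ weight w γ′) →
                              SpansComplement G (levelSet w t) γ
  minWeight⇒spansComplement {w} {t} {γ} w≤t γ-tree minimal f f∉K
    with Reach? (λ e → (e ∈? γ) ×-dec ¬? (e ∈? levelSet w t)) (src G f) (tgt G f)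
  ... | yes r = r
  ... | no ¬r with fundamental-exchange γ-tree f∉K ¬r
  ...   | g , g∈γ , g∈K , f∉γ , γ′-tree = ⊥-elim (ℚ.<-irrefl refl (begin-strict
    weight w γ + t                  ≤⟨ ℚ.+-monoˡ-≤ t (minimal _ γ′-tree) ⟩
    weight w (exchange γ g f) + t   ≡⟨ cong (weight w (exchange γ g f) +_) (∈-levelSet⁻ {w = w} g∈K) ⟨
    weight w (exchange γ g f) + w g ≡⟨ weight-exchange g∈γ f∉γ w ⟩
    weight w γ + w f                <⟨ ℚ.+-monoʳ-< (weight w γ) (≤∧≢⇒< (w≤t f) (f∉K ∘ ∈-levelSet⁺ {w = w})) ⟩
    weight w γ + t                  ∎))
    where open ℚ.≤-Reasoning

-- Probability mass functions on edge sets

pmf-support : ∀ {m} {P : Subset m → Set} {μ} → IsPMF P μ → ∃ λ T → μ T ≢ 0ℚ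
pmf-support {m} {μ = μ} (_ , _ , ∑μ≡1) = ∑≢0⇒∃≢0 (allSubsets m) μ (λ ∑μ≡0 → case trans (sym ∑μ≡1) ∑μ≡0 of λ ())

mixture : ∀ {m} → (Subset m → ℚ) → (Subset m → Subset m → ℚ) → Subset m → ℚ
mixture {m} μ ν T = ∑[ γ ∈ allSubsets m ] (μ γ * ν γ T)

module _ {m : ℕ} {P Q : Subset m → Set} {μ : Subset m → ℚ} {ν : Subset m → Subset m → ℚ}
         (μ-pmf : IsPMF Q μ) (ν-pmf : ∀ γ → μ γ ≢ 0ℚ → IsPMF P (ν γ)) where

  private
    L : List (Subset m)
    L = allSubsets m

    weighted : ∀ γ {x : ℚ} → (μ γ ≢ 0ℚ → x ≡ 1ℚ) → μ γ * x ≡ μ γ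
    weighted γ {x} x≡1 with μ γ ℚ.≟ 0ℚ
    ... | yes μγ≡0 = trans (cong (_* x) μγ≡0) (trans (ℚ.*-zeroˡ x) (sym μγ≡0))
    ... | no μγ≢0  = trans (cong (μ γ *_) (x≡1 μγ≢0)) (ℚ.*-identityʳ (μ γ))

  mixture-isPMF : IsPMF P (mixture μ ν)
  mixture-isPMF = nonNeg , support , total
    where
    nonNeg : ∀ T → 0ℚ ≤ mixture μ ν T
    nonNeg T = ∑-nonNeg L term
      where
      term : ∀ γ → 0ℚ ≤ μ γ * ν γ T
      term γ with μ γ ℚ.≟ 0ℚ
      ... | yes μγ≡0 = ℚ.≤-reflexive (sym (trans (cong (_* ν γ T) μγ≡0) (ℚ.*-zeroˡ (ν γ T))))
      ... | no μγ≢0  = *-nonNeg (proj₁ μ-pmf γ) (proj₁ (ν-pmf γ μγ≢0) T)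
    support : ∀ T → mixture μ ν T ≢ 0ℚ → P T
    support T mix≢0 with ∑≢0⇒∃≢0 L _ mix≢0
    ... | γ , term≢0 = proj₁ (proj₂ (ν-pmf γ μγ≢0)) T (λ νγT≡0 → term≢0 (trans (cong (μ γ *_) νγT≡0) (ℚ.*-zeroʳ (μ γ))))
      where
      μγ≢0 : μ γ ≢ 0ℚ
      μγ≢0 μγ≡0 = term≢0 (trans (cong (_* ν γ T) μγ≡0) (ℚ.*-zeroˡ (ν γ T)))
    total : ∑ L (mixture μ ν) ≡ 1ℚ
    total = begin
      ∑[ T ∈ L ] ∑[ γ ∈ L ] (μ γ * ν γ T) ≡⟨ ∑-swap L L _ ⟩
      ∑[ γ ∈ L ] ∑[ T ∈ L ] (μ γ * ν γ T) ≡⟨ ∑-cong L (λ γ → ∑-*ˡ L (μ γ) (ν γ)) ⟩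
      ∑[ γ ∈ L ] (μ γ * ∑ L (ν γ))        ≡⟨ ∑-cong L (λ γ → weighted γ (λ μγ≢0 → proj₂ (proj₂ (ν-pmf γ μγ≢0)))) ⟩
      ∑ L μ                               ≡⟨ proj₂ (proj₂ μ-pmf) ⟩
      1ℚ                                  ∎
      where open ≡-Reasoning

usage-mixture : ∀ {m} (μ : Subset m → ℚ) (ν : Subset m → Subset m → ℚ) e →
                usage (mixture μ ν) e ≡ ∑[ γ ∈ allSubsets m ] (μ γ * usage (ν γ) e)
usage-mixture {m} μ ν e = begin
  ∑[ T ∈ L ] (if lookup T e then ∑[ γ ∈ L ] (μ γ * ν γ T) else 0ℚ)   ≡⟨ ∑-cong L (λ T → if-∑ (lookup T e) L _) ⟩
  ∑[ T ∈ L ] ∑[ γ ∈ L ] (if lookup T e then μ γ * ν γ T else 0ℚ)    ≡⟨ ∑-swap L L _ ⟩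
  ∑[ γ ∈ L ] ∑[ T ∈ L ] (if lookup T e then μ γ * ν γ T else 0ℚ)    ≡⟨ ∑-cong L (λ γ → ∑-cong L (λ T → if-*ˡ (lookup T e) (μ γ) (ν γ T))) ⟩
  ∑[ γ ∈ L ] ∑[ T ∈ L ] (μ γ * (if lookup T e then ν γ T else 0ℚ))  ≡⟨ ∑-cong L (λ γ → ∑-*ˡ L (μ γ) _) ⟩
  ∑[ γ ∈ L ] (μ γ * usage (ν γ) e)                                   ∎
  where
  open ≡-Reasoning
  L : List (Subset m)
  L = allSubsets m

image : ∀ {m} → (Subset m → Subset m) → (Subset m → ℚ) → Subset m → ℚ
image {m} F ν T = ∑[ S ∈ allSubsets m ] (if does (T ≟ₛ F S) then ν S else 0ℚ)

module _ {m : ℕ} (F : Subset m → Subset m) where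

  private
    L : List (Subset m)
    L = allSubsets m

  image-isPMF : ∀ {P Q : Subset m → Set} {ν} → IsPMF P ν → (∀ S → ν S ≢ 0ℚ → Q (F S)) → IsPMF Q (image F ν)
  image-isPMF {Q = Q} {ν} (ν-nonNeg , _ , ν-total) F-support = nonNeg , support , total
    where
    nonNeg : ∀ T → 0ℚ ≤ image F ν T
    nonNeg T = ∑-nonNeg L term
      where
      term : ∀ S → 0ℚ ≤ (if does (T ≟ₛ F S) then ν S else 0ℚ)
      term S with T ≟ₛ F S
      ... | yes _ = ν-nonNeg S
      ... | no _  = ℚ.≤-refl
    support : ∀ T → image F ν T ≢ 0ℚ → Q T
    support T im≢0 with ∑≢0⇒∃≢0 L _ im≢0
    ... | S , term≢0 with T ≟ₛ F S
    ...   | yes refl = F-support S term≢0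
    ...   | no _     = ⊥-elim (term≢0 refl)
    total : ∑ L (image F ν) ≡ 1ℚ
    total = begin
      ∑[ T ∈ L ] ∑[ S ∈ L ] (if does (T ≟ₛ F S) then ν S else 0ℚ) ≡⟨ ∑-swap L L _ ⟩
      ∑[ S ∈ L ] ∑[ T ∈ L ] (if does (T ≟ₛ F S) then ν S else 0ℚ) ≡⟨ ∑-cong L (λ S → ∑-allSubsets-point (F S) (ν S)) ⟩
      ∑ L ν                                                       ≡⟨ ν-total ⟩
      1ℚ                                                          ∎
      where open ≡-Reasoning

  usage-image : ∀ ν e → usage (image F ν) e ≡ ∑[ S ∈ allSubsets m ] (if lookup (F S) e then ν S else 0ℚ)
  usage-image ν e = begin
    ∑[ T ∈ L ] (if lookup T e then image F ν T else 0ℚ)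
      ≡⟨ ∑-cong L (λ T → if-∑ (lookup T e) L _) ⟩
    ∑[ T ∈ L ] ∑[ S ∈ L ] (if lookup T e then (if does (T ≟ₛ F S) then ν S else 0ℚ) else 0ℚ)
      ≡⟨ ∑-swap L L _ ⟩
    ∑[ S ∈ L ] ∑[ T ∈ L ] (if lookup T e then (if does (T ≟ₛ F S) then ν S else 0ℚ) else 0ℚ)
      ≡⟨ ∑-cong L (λ S → ∑-cong L (λ T → at-image T S)) ⟩
    ∑[ S ∈ L ] ∑[ T ∈ L ] (if does (T ≟ₛ F S) then (if lookup (F S) e then ν S else 0ℚ) else 0ℚ)
      ≡⟨ ∑-cong L (λ S → ∑-allSubsets-point (F S) _) ⟩
    ∑[ S ∈ L ] (if lookup (F S) e then ν S else 0ℚ) ∎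
    where
    open ≡-Reasoning
    at-image : ∀ T S → (if lookup T e then (if does (T ≟ₛ F S) then ν S else 0ℚ) else 0ℚ) ≡
                       (if does (T ≟ₛ F S) then (if lookup (F S) e then ν S else 0ℚ) else 0ℚ)
    at-image T S with T ≟ₛ F S
    ... | yes refl = refl
    ... | no _ with lookup T e
    ...   | true  = refl
    ...   | false = refl

point : ∀ {m} → Subset m → Subset m → ℚ
point X T = if does (T ≟ₛ X) then 1ℚ else 0ℚ

shift : ∀ {m} → (Subset m → ℚ) → ℚ → Subset m → Subset m → Subset m → ℚ
shift μ ε γ γ′ T = μ T + ε * (point γ′ T - point γ T)

member : ∀ {m} → Subset m → Fin m → ℚ
member X e = if lookup X e then 1ℚ else 0ℚ

member-* : ∀ {m} (X : Subset m) e x → member X e * x ≡ (if lookup X e then x else 0ℚ)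
member-* X e x with lookup X e
... | true  = ℚ.*-identityˡ x
... | false = ℚ.*-zeroˡ x

point-nonNeg : ∀ {m} (X T : Subset m) → 0ℚ ≤ point X T
point-nonNeg X T with T ≟ₛ X
... | yes _ = ℚ.<⇒≤ (ℚ.positive⁻¹ 1ℚ)
... | no _  = ℚ.≤-refl

usage-point : ∀ {m} (X : Subset m) e → usage (point X) e ≡ member X e
usage-point {m} X e = trans (∑-cong (allSubsets m) at-X) (∑-allSubsets-point X (member X e))
  where
  at-X : ∀ T → (if lookup T e then point X T else 0ℚ) ≡ (if does (T ≟ₛ X) then member X e else 0ℚ)
  at-X T with T ≟ₛ X
  ... | yes refl = refl
  ... | no _ with lookup T e
  ...   | true  = refl
  ...   | false = refl

usage-shift : ∀ {m} (μ : Subset m → ℚ) ε γ γ′ e →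
              usage (shift μ ε γ γ′) e ≡ usage μ e + ε * (member γ′ e - member γ e)
usage-shift {m} μ ε γ γ′ e = begin
  ∑[ T ∈ L ] (if lookup T e then μ T + ε * (point γ′ T - point γ T) else 0ℚ)
    ≡⟨ ∑-cong L (λ T → distribute (lookup T e)) ⟩
  ∑[ T ∈ L ] ((if lookup T e then μ T else 0ℚ) +
              ε * ((if lookup T e then point γ′ T else 0ℚ) - (if lookup T e then point γ T else 0ℚ)))
    ≡⟨ ∑-+ L _ _ ⟩
  usage μ e + ∑[ T ∈ L ] (ε * ((if lookup T e then point γ′ T else 0ℚ) - (if lookup T e then point γ T else 0ℚ)))
    ≡⟨ cong (usage μ e +_) (trans (∑-*ˡ L ε _) (cong (ε *_) (∑-minus L _ _))) ⟩
  usage μ e + ε * (usage (point γ′) e - usage (point γ) e)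
    ≡⟨ cong₂ (λ a b → usage μ e + ε * (a - b)) (usage-point γ′ e) (usage-point γ e) ⟩
  usage μ e + ε * (member γ′ e - member γ e) ∎
  where
  open ≡-Reasoning
  L : List (Subset m)
  L = allSubsets m
  distribute : ∀ {x y z} b → (if b then x + ε * (y - z) else 0ℚ) ≡
                             (if b then x else 0ℚ) + ε * ((if b then y else 0ℚ) - (if b then z else 0ℚ))
  distribute true  = refl
  distribute false = solve 1 (λ ε → con 0ℚ := con 0ℚ :+ ε :* (con 0ℚ :- con 0ℚ)) refl ε
    where open ℚ-Solver

module _ {m : ℕ} {P : Subset m → Set} {μ : Subset m → ℚ} (μ-pmf : IsPMF P μ) where

  private
    L : List (Subset m)
    L = allSubsets m
    open ℚ-Solver

  shift-isPMF : ∀ {ε γ γ′} → 0ℚ < ε → ε ≤ μ γ → P γ′ → IsPMF P (shift μ ε γ γ′)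
  shift-isPMF {ε} {γ} {γ′} 0<ε ε≤μγ Pγ′ = nonNeg , support , total
    where
    μ-nonNeg : ∀ T → 0ℚ ≤ μ T
    μ-nonNeg = proj₁ μ-pmf
    μ-support : ∀ T → μ T ≢ 0ℚ → P T
    μ-support = proj₁ (proj₂ μ-pmf)
    nonNeg : ∀ T → 0ℚ ≤ shift μ ε γ γ′ T
    nonNeg T with T ≟ₛ γ
    ... | yes refl = subst (0ℚ ≤_) (solve 3 (λ μγ ε x → (μγ :- ε) :+ ε :* x := μγ :+ ε :* (x :- con 1ℚ)) refl (μ γ) ε (point γ′ γ))
                       (ℚ.+-mono-≤ (p≤q⇒0≤q-p ε≤μγ) (*-nonNeg (ℚ.<⇒≤ 0<ε) (point-nonNeg γ′ γ)))
    ... | no _     = subst (0ℚ ≤_) (solve 3 (λ μT ε x → μT :+ ε :* x := μT :+ ε :* (x :- con 0ℚ)) refl (μ T) ε (point γ′ T))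
                       (ℚ.+-mono-≤ (μ-nonNeg T) (*-nonNeg (ℚ.<⇒≤ 0<ε) (point-nonNeg γ′ T)))
    support : ∀ T → shift μ ε γ γ′ T ≢ 0ℚ → P T
    support T shift≢0 with T ≟ₛ γ′ | μ T ℚ.≟ 0ℚ
    ... | yes refl | _       = Pγ′
    ... | no _     | no μT≢0 = μ-support T μT≢0
    ... | no T≢γ′  | yes μT≡0 with T ≟ₛ γ
    ...   | yes refl = ⊥-elim (ℚ.<-irrefl refl (ℚ.<-≤-trans 0<ε (subst (ε ≤_) μT≡0 ε≤μγ)))
    ...   | no _     = ⊥-elim (shift≢0 (trans (cong (_+ ε * (0ℚ - 0ℚ)) μT≡0)
                                             (solve 1 (λ ε → con 0ℚ :+ ε :* (con 0ℚ :- con 0ℚ) := con 0ℚ) refl ε)))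
    total : ∑ L (shift μ ε γ γ′) ≡ 1ℚ
    total = begin
      ∑[ T ∈ L ] (μ T + ε * (point γ′ T - point γ T))       ≡⟨ ∑-+ L μ _ ⟩
      ∑ L μ + ∑[ T ∈ L ] (ε * (point γ′ T - point γ T))     ≡⟨ cong (∑ L μ +_) (trans (∑-*ˡ L ε _) (cong (ε *_) (∑-minus L _ _))) ⟩
      ∑ L μ + ε * (∑ L (point γ′) - ∑ L (point γ))          ≡⟨ cong₂ (λ a b → a + ε * (b - ∑ L (point γ))) (proj₂ (proj₂ μ-pmf)) (∑-allSubsets-point γ′ 1ℚ) ⟩
      1ℚ + ε * (1ℚ - ∑ L (point γ))                         ≡⟨ cong (λ b → 1ℚ + ε * (1ℚ - b)) (∑-allSubsets-point γ 1ℚ) ⟩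
      1ℚ + ε * (1ℚ - 1ℚ)                                    ≡⟨ solve 1 (λ ε → con 1ℚ :+ ε :* (con 1ℚ :- con 1ℚ) := con 1ℚ) refl ε ⟩
      1ℚ                                                    ∎
      where open ≡-Reasoning

  mean-const : ∀ {f : Subset m → ℚ} {c} → (∀ T → μ T ≢ 0ℚ → f T ≡ c) → ∑[ T ∈ L ] (μ T * f T) ≡ c
  mean-const {f} {c} f≡c = begin
    ∑[ T ∈ L ] (μ T * f T) ≡⟨ ∑-cong L on-support ⟩
    ∑[ T ∈ L ] (μ T * c)   ≡⟨ ∑-*ʳ L c μ ⟩
    ∑ L μ * c              ≡⟨ cong (_* c) (proj₂ (proj₂ μ-pmf)) ⟩
    1ℚ * c                 ≡⟨ ℚ.*-identityˡ c ⟩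
    c                      ∎
    where
    open ≡-Reasoning
    on-support : ∀ T → μ T * f T ≡ μ T * c
    on-support T with μ T ℚ.≟ 0ℚ
    ... | yes μT≡0 = trans (cong (_* f T) μT≡0) (trans (ℚ.*-zeroˡ (f T)) (sym (trans (cong (_* c) μT≡0) (ℚ.*-zeroˡ c))))
    ... | no μT≢0  = cong (μ T *_) (f≡c T μT≢0)

  mean≤min⇒const : ∀ {f : Subset m → ℚ} {c} → (∀ T → P T → c ≤ f T) → ∑[ T ∈ L ] (μ T * f T) ≤ c →
                   ∀ T → μ T ≢ 0ℚ → f T ≡ c
  mean≤min⇒const {f} {c} c≤f mean≤c T μT≢0 = ℚ.≤-antisym fT≤c (c≤f T (proj₁ (proj₂ μ-pmf) T μT≢0))
    where
    excess : Subset m → ℚ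
    excess T = μ T * (f T - c)
    excess-nonNeg : ∀ T → 0ℚ ≤ excess T
    excess-nonNeg T with μ T ℚ.≟ 0ℚ
    ... | yes μT≡0 = ℚ.≤-reflexive (sym (trans (cong (_* (f T - c)) μT≡0) (ℚ.*-zeroˡ (f T - c))))
    ... | no μT≢0  = *-nonNeg (proj₁ μ-pmf T) (p≤q⇒0≤q-p (c≤f T (proj₁ (proj₂ μ-pmf) T μT≢0)))
    ∑excess : ∑ L excess ≡ ∑[ T ∈ L ] (μ T * f T) - c
    ∑excess = begin
      ∑[ T ∈ L ] (μ T * (f T - c))                  ≡⟨ ∑-cong L (λ T → solve 3 (λ μT fT c → μT :* (fT :- c) := μT :* fT :- μT :* c) refl (μ T) (f T) c) ⟩
      ∑[ T ∈ L ] (μ T * f T - μ T * c)              ≡⟨ ∑-minus L _ _ ⟩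
      ∑[ T ∈ L ] (μ T * f T) - ∑[ T ∈ L ] (μ T * c) ≡⟨ cong (λ z → ∑[ T ∈ L ] (μ T * f T) - z) (mean-const (λ _ _ → refl)) ⟩
      ∑[ T ∈ L ] (μ T * f T) - c                    ∎
      where open ≡-Reasoning
    excess≡0 : excess T ≡ 0ℚ
    excess≡0 = ∑-nonNeg≤0⇒0 L excess-nonNeg (subst (_≤ 0ℚ) (sym ∑excess) (p≤q⇒p-q≤0 mean≤c)) (∈-allSubsets T)
    fT≤c : f T ≤ c
    fT≤c = p-q≤0⇒p≤q (ℚ.*-cancelˡ-≤-pos (μ T) {{positive (≤∧≢⇒< (proj₁ μ-pmf T) (μT≢0 ∘ sym))}}
                        (subst₂ _≤_ (sym excess≡0) (sym (ℚ.*-zeroʳ (μ T))) ℚ.≤-refl))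

splicePMF : ∀ {m} {E : EdgeSet m} → Decidable E → (Subset m → ℚ) → (Subset m → ℚ) → Subset m → ℚ
splicePMF E? μ ν = mixture μ (λ γ → image (splice E? γ) ν)

module _ {m : ℕ} {E : EdgeSet m} (E? : Decidable E) {P Q : Subset m → Set} {μ ν : Subset m → ℚ}
         (μ-pmf : IsPMF P μ) (ν-pmf : IsPMF Q ν) where

  private
    L : List (Subset m)
    L = allSubsets m

  splicePMF-isPMF : ∀ {R : Subset m → Set} → (∀ {γ S} → μ γ ≢ 0ℚ → ν S ≢ 0ℚ → R (splice E? γ S)) →
                    IsPMF R (splicePMF E? μ ν)
  splicePMF-isPMF spliced = mixture-isPMF μ-pmf (λ γ μγ≢0 → image-isPMF (splice E? γ) ν-pmf (λ S → spliced μγ≢0))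

  usage-splicePMF-inside : ∀ {e} → E e → usage (splicePMF E? μ ν) e ≡ usage ν e
  usage-splicePMF-inside {e} ee = begin
    usage (splicePMF E? μ ν) e                                            ≡⟨ usage-mixture μ _ e ⟩
    ∑[ γ ∈ L ] (μ γ * usage (image (splice E? γ) ν) e)                    ≡⟨ ∑-cong L (λ γ → cong (μ γ *_) (trans (usage-image (splice E? γ) ν e) (∑-cong L (selects-S γ)))) ⟩
    ∑[ γ ∈ L ] (μ γ * usage ν e)                                          ≡⟨ ∑-*ʳ L (usage ν e) μ ⟩
    ∑ L μ * usage ν e                                                     ≡⟨ cong (_* usage ν e) (proj₂ (proj₂ μ-pmf)) ⟩
    1ℚ * usage ν e                                                        ≡⟨ ℚ.*-identityˡ (usage ν e) ⟩
    usage ν e                                                             ∎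
    where
    open ≡-Reasoning
    selects-S : ∀ γ S → (if lookup (splice E? γ S) e then ν S else 0ℚ) ≡ (if lookup S e then ν S else 0ℚ)
    selects-S γ S with E? e | Splice.lookup-splice E? γ S e
    ... | yes _  | eq = cong (λ b → if b then ν S else 0ℚ) eq
    ... | no ¬ee | _  = ⊥-elim (¬ee ee)

  usage-splicePMF-outside : ∀ {e} → ¬ E e → usage (splicePMF E? μ ν) e ≡ usage μ e
  usage-splicePMF-outside {e} ¬ee = begin
    usage (splicePMF E? μ ν) e                                            ≡⟨ usage-mixture μ _ e ⟩
    ∑[ γ ∈ L ] (μ γ * usage (image (splice E? γ) ν) e)                    ≡⟨ ∑-cong L (λ γ → cong (μ γ *_) (trans (usage-image (splice E? γ) ν e) (∑-cong L (selects-γ γ)))) ⟩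
    ∑[ γ ∈ L ] (μ γ * ∑[ S ∈ L ] (if lookup γ e then ν S else 0ℚ))       ≡⟨ ∑-cong L (λ γ → cong (μ γ *_) (trans (sym (if-∑ (lookup γ e) L ν)) (cong (λ x → if lookup γ e then x else 0ℚ) (proj₂ (proj₂ ν-pmf))))) ⟩
    ∑[ γ ∈ L ] (μ γ * member γ e)                                         ≡⟨ ∑-cong L (λ γ → trans (ℚ.*-comm (μ γ) (member γ e)) (member-* γ e (μ γ))) ⟩
    usage μ e                                                             ∎
    where
    open ≡-Reasoning
    selects-γ : ∀ γ S → (if lookup (splice E? γ S) e then ν S else 0ℚ) ≡ (if lookup γ e then ν S else 0ℚ)
    selects-γ γ S with E? e | Splice.lookup-splice E? γ S e
    ... | yes ee | _  = ⊥-elim (¬ee ee)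
    ... | no _   | eq = cong (λ b → if b then ν S else 0ℚ) eq

-- Optimal pmfs

∑-square-shift : ∀ {A : Set} (xs : List A) (u d : A → ℚ) (ε : ℚ) →
                 ∑[ x ∈ xs ] ((u x + ε * d x) * (u x + ε * d x)) ≡
                 ∑[ x ∈ xs ] (u x * u x) + ε * ((1ℚ + 1ℚ) * ∑[ x ∈ xs ] (d x * u x) + ε * ∑[ x ∈ xs ] (d x * d x))
∑-square-shift xs u d ε = begin
  ∑[ x ∈ xs ] ((u x + ε * d x) * (u x + ε * d x))
    ≡⟨ ∑-cong xs (λ x → expand (u x) (d x)) ⟩
  ∑[ x ∈ xs ] (u x * u x + ε * ((1ℚ + 1ℚ) * (d x * u x) + ε * (d x * d x)))
    ≡⟨ ∑-+ xs _ _ ⟩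
  ∑[ x ∈ xs ] (u x * u x) + ∑[ x ∈ xs ] (ε * ((1ℚ + 1ℚ) * (d x * u x) + ε * (d x * d x)))
    ≡⟨ cong (∑[ x ∈ xs ] (u x * u x) +_) (trans (∑-*ˡ xs ε _) (cong (ε *_) (∑-+ xs _ _))) ⟩
  ∑[ x ∈ xs ] (u x * u x) + ε * (∑[ x ∈ xs ] ((1ℚ + 1ℚ) * (d x * u x)) + ∑[ x ∈ xs ] (ε * (d x * d x)))
    ≡⟨ cong₂ (λ a b → ∑[ x ∈ xs ] (u x * u x) + ε * (a + b)) (∑-*ˡ xs (1ℚ + 1ℚ) (λ x → d x * u x)) (∑-*ˡ xs ε (λ x → d x * d x)) ⟩
  ∑[ x ∈ xs ] (u x * u x) + ε * ((1ℚ + 1ℚ) * ∑[ x ∈ xs ] (d x * u x) + ε * ∑[ x ∈ xs ] (d x * d x)) ∎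
  where
  open ≡-Reasoning
  open ℚ-Solver
  expand : ∀ a b → (a + ε * b) * (a + ε * b) ≡ a * a + ε * ((1ℚ + 1ℚ) * (b * a) + ε * (b * b))
  expand a b = solve 3 (λ a b ε → (a :+ ε :* b) :* (a :+ ε :* b) :=
                                  a :* a :+ ε :* ((con 1ℚ :+ con 1ℚ) :* (b :* a) :+ ε :* (b :* b))) refl a b ε

-- Choosing ε = p a / (p Q + a) with a = - D makes the quadratic negative when D < 0.
quadratic-nonNeg⇒slope-nonNeg : ∀ {p D Q} → 0ℚ < p → 0ℚ ≤ Q →
  (∀ ε → 0ℚ < ε → ε ≤ p → 0ℚ ≤ ε * ((1ℚ + 1ℚ) * D + ε * Q)) → 0ℚ ≤ D
quadratic-nonNeg⇒slope-nonNeg {p} {D} {Q} 0<p 0≤Q nonNeg with 0ℚ ℚ.≤? D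
... | yes 0≤D = 0≤D
... | no 0≰D  = ⊥-elim (ℚ.<-irrefl refl (ℚ.<-≤-trans (ℚ.neg-antimono-< 0<X) (subst (0ℚ ≤_) value (nonNeg ε 0<ε ε≤p))))
  where
  open ℚ-Solver
  a : ℚ
  a = - D
  0<a : 0ℚ < a
  0<a = ℚ.neg-antimono-< (ℚ.≰⇒> 0≰D)
  r : ℚ
  r = p * Q + a
  0<r : 0ℚ < r
  0<r = ℚ.+-mono-≤-< (*-nonNeg (ℚ.<⇒≤ 0<p) 0≤Q) 0<a
  instance
    _ : Positive r
    _ = positive 0<r
    _ : NonZero r
    _ = ℚ.pos⇒nonZero r
  ir : ℚ
  ir = 1/ r
  0<ir : 0ℚ < ir
  0<ir = ℚ.positive⁻¹ ir {{ℚ.1/pos⇒pos r}}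
  r*ir≡1 : r * ir ≡ 1ℚ
  r*ir≡1 = ℚ.*-inverseʳ r
  ε : ℚ
  ε = p * a * ir
  0<ε : 0ℚ < ε
  0<ε = *-pos (*-pos 0<p 0<a) 0<ir
  ε≤p : ε ≤ p
  ε≤p = 0≤q-p⇒p≤q (subst (0ℚ ≤_) p-ε (*-nonNeg (*-nonNeg (*-nonNeg (ℚ.<⇒≤ 0<p) (ℚ.<⇒≤ 0<p)) 0≤Q) (ℚ.<⇒≤ 0<ir)))
    where
    p-ε : p * p * Q * ir ≡ p - ε
    p-ε = begin
      p * p * Q * ir   ≡⟨ solve 4 (λ p D Q ir → p :* p :* Q :* ir := p :* ((p :* Q :+ (:- D)) :* ir) :- p :* (:- D) :* ir) refl p D Q ir ⟩
      p * (r * ir) - ε ≡⟨ cong (λ z → p * z - ε) r*ir≡1 ⟩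
      p * 1ℚ - ε       ≡⟨ cong (_- ε) (ℚ.*-identityʳ p) ⟩
      p - ε            ∎
      where open ≡-Reasoning
  X : ℚ
  X = ε * ir * a * (p * Q + (1ℚ + 1ℚ) * a)
  0<X : 0ℚ < X
  0<X = *-pos (*-pos (*-pos 0<ε 0<ir) 0<a)
          (ℚ.+-mono-≤-< (*-nonNeg (ℚ.<⇒≤ 0<p) 0≤Q) (*-pos (ℚ.+-mono-< (ℚ.positive⁻¹ 1ℚ) (ℚ.positive⁻¹ 1ℚ)) 0<a))
  value : ε * ((1ℚ + 1ℚ) * D + ε * Q) ≡ - X
  value = begin
    ε * ((1ℚ + 1ℚ) * D + ε * Q)            ≡⟨ cong (λ z → ε * (z + ε * Q)) (ℚ.*-identityʳ ((1ℚ + 1ℚ) * D)) ⟨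
    ε * ((1ℚ + 1ℚ) * D * 1ℚ + ε * Q)       ≡⟨ cong (λ z → ε * ((1ℚ + 1ℚ) * D * z + ε * Q)) r*ir≡1 ⟨
    ε * ((1ℚ + 1ℚ) * D * (r * ir) + ε * Q) ≡⟨ solve 4 (λ p D Q ir →
        (p :* (:- D) :* ir) :* ((con 1ℚ :+ con 1ℚ) :* D :* ((p :* Q :+ (:- D)) :* ir) :+ (p :* (:- D) :* ir) :* Q) :=
        :- ((p :* (:- D) :* ir) :* ir :* (:- D) :* (p :* Q :+ (con 1ℚ :+ con 1ℚ) :* (:- D)))) refl p D Q ir ⟩
    - X                                    ∎
    where open ≡-Reasoning

module _ {n m : ℕ} {G : Multigraph n m} {μ : Subset m → ℚ} (optimal : OptimalPMF G μ) where

  support-minimisesWeight : ∀ {γ γ′} → μ γ ≢ 0ℚ → SpanningTree G γ′ → weight (usage μ) γ ≤ weight (usage μ) γ′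
  support-minimisesWeight {γ} {γ′} μγ≢0 γ′-tree =
    0≤q-p⇒p≤q (subst (0ℚ ≤_) D≡Δweight (quadratic-nonNeg⇒slope-nonNeg 0<μγ (∑-nonNeg Es (λ e → square-nonNeg (d e))) improvement))
    where
    open ℚ-Solver
    Es : List (Fin m)
    Es = allFin m
    η : Fin m → ℚ
    η = usage μ
    d : Fin m → ℚ
    d e = member γ′ e - member γ e
    D Q : ℚ
    D = ∑[ e ∈ Es ] (d e * η e)
    Q = ∑[ e ∈ Es ] (d e * d e)

    square-nonNeg : ∀ x → 0ℚ ≤ x * x
    square-nonNeg x with ℚ.≤-total 0ℚ x
    ... | inj₁ 0≤x = *-nonNeg 0≤x 0≤x
    ... | inj₂ x≤0 = subst (0ℚ ≤_) (solve 1 (λ x → (con 0ℚ :- x) :* (con 0ℚ :- x) := x :* x) refl x)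
                       (*-nonNeg (p≤q⇒0≤q-p x≤0) (p≤q⇒0≤q-p x≤0))

    0<μγ : 0ℚ < μ γ
    0<μγ = ≤∧≢⇒< (proj₁ (proj₁ optimal) γ) (μγ≢0 ∘ sym)

    D≡Δweight : D ≡ weight η γ′ - weight η γ
    D≡Δweight = trans (∑-cong Es λ e → trans (solve 3 (λ a b x → (a :- b) :* x := a :* x :- b :* x) refl (member γ′ e) (member γ e) (η e))
                                              (cong₂ _-_ (member-* γ′ e (η e)) (member-* γ e (η e))))
                      (∑-minus Es _ _)

    improvement : ∀ ε → 0ℚ < ε → ε ≤ μ γ → 0ℚ ≤ ε * ((1ℚ + 1ℚ) * D + ε * Q)
    improvement ε 0<ε ε≤μγ = subst (0ℚ ≤_) (solve 2 (λ c x → (c :+ x) :- c := x) refl (cost μ) _) (p≤q⇒0≤q-p optimality)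
      where
      ν : Subset m → ℚ
      ν = shift μ ε γ γ′
      cost-ν : cost ν ≡ cost μ + ε * ((1ℚ + 1ℚ) * D + ε * Q)
      cost-ν = trans (∑-cong Es (λ e → cong₂ _*_ (usage-shift μ ε γ γ′ e) (usage-shift μ ε γ γ′ e)))
                     (∑-square-shift Es η d ε)
      optimality : cost μ ≤ cost μ + ε * ((1ℚ + 1ℚ) * D + ε * Q)
      optimality = subst (cost μ ≤_) cost-ν (proj₂ optimal ν (shift-isPMF (proj₁ optimal) 0<ε ε≤μγ γ′-tree))

module _ {n m : ℕ} {G : Multigraph n (suc m)} {μ : Subset (suc m) → ℚ} (optimal : OptimalPMF G μ) where

  private
    η : Fin (suc m) → ℚ
    η = usage μ
    μ-pmf : IsPMF (SpanningTree G) μ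
    μ-pmf = proj₁ optimal
    emax : Fin (suc m)
    emax = proj₁ (argmax η)
    ηmax : ℚ
    ηmax = η emax
    η≤ηmax : ∀ e → η e ≤ ηmax
    η≤ηmax = proj₂ (argmax η)
    K : Subset (suc m)
    K = levelSet η ηmax

  support-spanningTree : ∀ {γ} → μ γ ≢ 0ℚ → SpanningTree G γ
  support-spanningTree = proj₁ (proj₂ μ-pmf) _

  support-meets-maxUsage-minimally : ∀ {γ} → μ γ ≢ 0ℚ → MeetsMinimally G K γ
  support-meets-maxUsage-minimally {γ} μγ≢0 =
    spansComplement⇒minimal tree (minWeight⇒spansComplement η≤ηmax tree (λ _ → support-minimisesWeight optimal μγ≢0))
    where
    tree : SpanningTree G γ
    tree = support-spanningTree μγ≢0

  maxUsage-isTheta : IsTheta G K ηmax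
  maxUsage-isTheta = k , ((γs , support-spanningTree μγs≢0 , refl) , support-meets-maxUsage-minimally μγs≢0) , θ-eq
    where
    γs : Subset (suc m)
    γs = proj₁ (pmf-support μ-pmf)
    μγs≢0 : μ γs ≢ 0ℚ
    μγs≢0 = proj₂ (pmf-support μ-pmf)
    k : ℕ
    k = ∣ γs ∩ K ∣
    same-count : ∀ T → μ T ≢ 0ℚ → fromℕ ∣ T ∩ K ∣ ≡ fromℕ k
    same-count T μT≢0 = cong fromℕ (ℕₚ.≤-antisym (support-meets-maxUsage-minimally μT≢0 γs (support-spanningTree μγs≢0))
                                                (support-meets-maxUsage-minimally μγs≢0 T (support-spanningTree μT≢0)))
    mass : ηmax * fromℕ ∣ K ∣ ≡ fromℕ k
    mass = begin
      ηmax * fromℕ ∣ K ∣                                  ≡⟨ weight-const ηmax K ⟨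
      weight (λ _ → ηmax) K                               ≡⟨ weight-cong K (sym ∘ ∈-levelSet⁻ {w = η}) ⟩
      weight η K                                          ≡⟨ weight-usage μ K ⟩
      ∑[ T ∈ allSubsets (suc m) ] (μ T * fromℕ ∣ T ∩ K ∣) ≡⟨ mean-const μ-pmf same-count ⟩
      fromℕ k                                             ∎
      where open ≡-Reasoning
    θ-eq : ηmax ≡ θval k ∣ K ∣
    θ-eq = θval-unique k ∣ K ∣ (ℕₚ.≤-<-trans z≤n (x∈p⇒∣p-x∣<∣p∣ (∈-levelSet⁺ {w = η} {e = emax} refl))) mass

  support-meets-critical-minimally : ∀ {J} → Critical G J → ∀ {γ} → μ γ ≢ 0ℚ → MeetsMinimally G J γ
  support-meets-critical-minimally {J} (_ , (kJ , (_ , kJ≤) , tJ≡θJ) , maximal) {γ} μγ≢0 γ′ γ′-tree =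
    ℕₚ.≤-trans (fromℕ-cancel-≤ _ _ (ℚ.≤-reflexive count≡kJ)) (kJ≤ γ′ γ′-tree)
    where
    mean≤kJ : ∑[ T ∈ allSubsets (suc m) ] (μ T * fromℕ ∣ T ∩ J ∣) ≤ fromℕ kJ
    mean≤kJ = begin
      ∑[ T ∈ allSubsets (suc m) ] (μ T * fromℕ ∣ T ∩ J ∣) ≡⟨ weight-usage μ J ⟨
      weight η J                                          ≤⟨ weight-mono-≤ η≤ηmax J ⟩
      weight (λ _ → ηmax) J                               ≡⟨ weight-const ηmax J ⟩
      ηmax * fromℕ ∣ J ∣                                  ≤⟨ ≤θval⇒*fromℕ≤ kJ ∣ J ∣ (subst (ηmax ≤_) tJ≡θJ (maximal K ηmax maxUsage-isTheta)) ⟩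
      fromℕ kJ                                            ∎
      where open ℚ.≤-Reasoning
    count≡kJ : fromℕ ∣ γ ∩ J ∣ ≡ fromℕ kJ
    count≡kJ = mean≤min⇒const μ-pmf (λ T tree → fromℕ-mono-≤ (kJ≤ T tree)) mean≤kJ γ μγ≢0

lemma9 : {n m : ℕ} (G : Multigraph (suc n) (suc m)) → Connected G →
    (μ* : Subset (suc m) → ℚ) → OptimalPMF G μ* →
    (J : Subset (suc m)) → Critical G J →
    (v : Fin (suc n)) →
    let Vi : Fin (suc n) → Set
        Vi u = Reach G (λ e → e ∉ J) v u
        Ei : Fin (suc m) → Set
        Ei e = Vi (src G e) × Vi (tgt G e)
    in (μi : Subset (suc m) → ℚ) → IsPMF (SpanningTreeOn G Vi) μi →
    Σ (Subset (suc m) → ℚ) λ μ → IsPMF (SpanningTree G) μ ×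
      (∀ e → Ei e → usage μ e ≡ usage μi e) ×
      (∀ e → ¬ Ei e → usage μ e ≡ usage μ* e)
lemma9 G _ μ* optimal J critical v μi μi-pmf =
  splicePMF Ei? μ* μi ,
  splicePMF-isPMF Ei? (proj₁ optimal) μi-pmf spliced-tree ,
  (λ e → usage-splicePMF-inside Ei? (proj₁ optimal) μi-pmf) ,
  (λ e → usage-splicePMF-outside Ei? (proj₁ optimal) μi-pmf)
  where
  Vi? : Decidable (Reach G (λ e → e ∉ J) v)
  Vi? = Reach? (λ e → ¬? (e ∈? J)) v
  Ei? : Decidable (Induced G (Reach G (λ e → e ∉ J) v))
  Ei? = Induced? G Vi?
  spliced-tree : ∀ {γ S} → μ* γ ≢ 0ℚ → μi S ≢ 0ℚ → SpanningTree G (splice Ei? γ S)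
  spliced-tree {γ} μ*γ≢0 μiS≢0 =
    splice-spanningTree Vi? γ-tree (component-spanned (minimal⇒spansComplement γ-tree (support-meets-critical-minimally optimal critical μ*γ≢0)))
                        (proj₁ (proj₂ μi-pmf) _ μiS≢0)
    where
    γ-tree : SpanningTree G γ
    γ-tree = support-spanningTree optimal μ*γ≢0
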